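{- Let $n\ge 1$, $l\ge 2$ and $1\le i,j\le n$, and let $Z(n,l;i,j)=\sum_{A\in \mathrm{ASTZ}_{n,l}^{i,j}} M^{\mu(A)}R^{r(A)}P^{p(A)}Q^{q(A)}$, a polynomial in the indeterminates $M,R,P,Q$. Then: (1) $Z(n,l;i,j)=0$ if $i>j$, and $Z(n,l;i,j)=R$ if $i=j$; (2) $Z(n,l;i,j)=Z(n-1,l;i,j)$ if $j<n$; (3) $Z(n,l;i,n)=Z(n-1,l+2;i-1,n-1)$ if $i>1$.
   Context: For $n\ge1$, $l\ge2$, an $(n,l)$-alternating sign trapezoid (ASTZ) is an array $(a_{r,c})_{1\le r\le n,\ r\le c\le 2n+l-1-r}$ with entries in $\{ -1,0,1\}$ (row $r$ occupies columns $r,\dots,2n+l-1-r$, so the rows form a trapezoid with $n$ rows, top row of length $2n+l-2$, bottom row of length $l$) such that: the nonzero entries alternate in sign along each row and each column; the topmost nonzero entry of each column is $1$; each row sums to $1$; each of the central $l-2$ columns sums to $0$. A column summing to $1$ is a $1$-column, otherwise it is a $0$-column. A $1$-column whose bottom entry is $0$ is a $10$-column. The $n$ leftmost columns are numbered $-n,\dots,-1$ from left to right and the $n$ rightmost columns are numbered $1,\dots,n$ from left to right. Statistics: $\mu(A)$ = number of $-1$ entries; $r(A)$ = number of $1$-columns among the $n$ leftmost columns; $p(A)$ = number of $10$-columns among the $n$ leftmost columns; $q(A)$ = number of $10$-columns among the $n$ rightmost columns. $\mathrm{ASTZ}_{n,l}^{i,j}$ denotes the set of $(n,l)$-ASTZs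 having exactly one $1$-column among the $n$ leftmost columns, located at position $-i$, and exactly one $0$-column among the $n$ rightmost columns, located at position $j$. -}

module Defs where

open import Data.Nat using (ℕ; zero; suc; _+_; _*_; _∸_; _⊓_; _≡ᵇ_; _<ᵇ_)
open import Data.Bool using (Bool; true; false; _∧_; not; if_then_else_)
open import Data.List using (List; []; _∷_; [_]; map; concatMap; concat; length; upTo; filterᵇ; foldr)
open import Data.Bool.ListAction using (and)
open import Data.Integer as ℤ using (ℤ)
open import Relation.Nullary using (does)

data E : Set where
  m1 z0 p1 : E

val : E → ℤ
val m1 = ℤ.-1ℤ
val z0 = ℤ.0ℤ
val p1 = ℤ.1ℤ

isZero : E → Bool
isZero z0 = true
isZero _  = false

isNeg : E → Bool
isNeg m1 = true
isNeg _  = false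

sumE : List E → ℤ
sumE xs = foldr (λ x s → val x ℤ.+ s) ℤ.0ℤ xs

_==ℤ_ : ℤ → ℤ → Bool
x ==ℤ y = does (x ℤ.≟ y)

range1 : ℕ → List ℕ
range1 k = map suc (upTo k)

rangeFT : ℕ → ℕ → List ℕ
rangeFT a b = map (λ k → a + k) (upTo (suc b ∸ a))

count : {A : Set} → (A → Bool) → List A → ℕ
count p xs = length (filterᵇ p xs)

allL : {A : Set} → (A → Bool) → List A → Bool
allL p xs = and (map p xs)

nonzeros : List E → List E
nonzeros = filterᵇ (λ x → not (isZero x))

alternatingNZ : List E → Bool
alternatingNZ [] = true
alternatingNZ (x ∷ []) = true
alternatingNZ (m1 ∷ m1 ∷ xs) = false
alternatingNZ (p1 ∷ p1 ∷ xs) = false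
alternatingNZ (x ∷ y ∷ xs) = alternatingNZ (y ∷ xs)

headIsPosOrEmpty : List E → Bool
headIsPosOrEmpty [] = true
headIsPosOrEmpty (p1 ∷ _) = true
headIsPosOrEmpty (_ ∷ _) = false

alternates : List E → Bool
alternates xs = alternatingNZ (nonzeros xs)

-- An (n,l)-array is stored as the list of its rows
-- (row 1 first); row r (1-based) lists the entries a_{r,c} for
-- c = r, ..., 2n+l-1-r, so it has length 2n+l-2r.
-- Columns are numbered 1, ..., 2n+l-2.

Array : Set
Array = List (List E)

words : ℕ → List (List E)
words zero = [ [] ]
words (suc k) = concatMap (λ w → map (_∷ w) (m1 ∷ z0 ∷ p1 ∷ [])) (words k)

rowLen : ℕ → ℕ → ℕ → ℕ
rowLen n l r = 2 * n + l ∸ 2 * r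

seqs : {A : Set} → List (List A) → List (List A)
seqs [] = [ [] ]
seqs (xs ∷ xss) = concatMap (λ x → map (x ∷_) (seqs xss)) xs

arrays : ℕ → ℕ → List Array
arrays n l = seqs (map (λ r → words (rowLen n l r)) (range1 n))

nth : {A : Set} → A → List A → ℕ → A
nth d [] _ = d
nth d (x ∷ xs) zero = x
nth d (x ∷ xs) (suc k) = nth d xs k

-- entry a_{r,c} (1-based row r, column c), 0 outside the trapezoid
entry : Array → ℕ → ℕ → E
entry A zero c = z0
entry A (suc r') c =
  if c <ᵇ suc r' then z0 else nth z0 (nth [] A r') (c ∸ suc r')

-- number of rows meeting column c (for 1 ≤ c ≤ 2n+l-2)
colHeight : ℕ → ℕ → ℕ → ℕ
colHeight n l c = (n ⊓ c) ⊓ (2 * n + l ∸ 1 ∸ c)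

column : ℕ → ℕ → Array → ℕ → List E
column n l A c = map (λ r → entry A r c) (range1 (colHeight n l c))

bottomEntry : ℕ → ℕ → Array → ℕ → E
bottomEntry n l A c = entry A (colHeight n l c) c

numCols : ℕ → ℕ → ℕ
numCols n l = 2 * n + l ∸ 2

isASTZ : ℕ → ℕ → Array → Bool
isASTZ n l A =
  allL (λ row → alternates row ∧ (sumE row ==ℤ ℤ.1ℤ)) A
  ∧ allL (λ c → alternates (column n l A c)
                 ∧ headIsPosOrEmpty (nonzeros (column n l A c)))
         (range1 (numCols n l))
  -- central l-2 columns n+1, ..., n+l-2 sum to 0
  ∧ allL (λ c → sumE (column n l A c) ==ℤ ℤ.0ℤ) (rangeFT (suc n) (n + l ∸ 2))

isOneCol : ℕ → ℕ → Array → ℕ → Bool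
isOneCol n l A c = sumE (column n l A c) ==ℤ ℤ.1ℤ

isTenCol : ℕ → ℕ → Array → ℕ → Bool
isTenCol n l A c = isOneCol n l A c ∧ isZero (bottomEntry n l A c)

-- leftmost column labelled -i is column n+1-i;
-- rightmost column labelled j is column n+l-2+j
leftCol : ℕ → ℕ → ℕ
leftCol n i = suc n ∸ i

rightCol : ℕ → ℕ → ℕ → ℕ
rightCol n l j = n + l ∸ 2 + j

_==B_ : Bool → Bool → Bool
true ==B b = b
false ==B b = not b

inIJ : ℕ → ℕ → ℕ → ℕ → Array → Bool
inIJ n l i j A =
  allL (λ i' → isOneCol n l A (leftCol n i') ==B (i' ≡ᵇ i)) (range1 n)
  ∧ allL (λ j' → not (isOneCol n l A (rightCol n l j')) ==B (j' ≡ᵇ j)) (range1 n)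

μ : Array → ℕ
μ A = count isNeg (concat A)

rStat : ℕ → ℕ → Array → ℕ
rStat n l A = count (λ i → isOneCol n l A (leftCol n i)) (range1 n)

pStat : ℕ → ℕ → Array → ℕ
pStat n l A = count (λ i → isTenCol n l A (leftCol n i)) (range1 n)

qStat : ℕ → ℕ → Array → ℕ
qStat n l A = count (λ j → isTenCol n l A (rightCol n l j)) (range1 n)

-- Polynomials in M, R, P, Q with ℕ coefficients, represented by their
-- coefficient function: coeff a b c d is the coefficient of M^a R^b P^c Q^d.

Poly : Set
Poly = ℕ → ℕ → ℕ → ℕ → ℕ

open import Relation.Binary.PropositionalEquality using (_≡_)

_≈P_ : Poly → Poly → Set
f ≈P g = ∀ a b c d → f a b c d ≡ g a b c d

0P : Poly
0P _ _ _ _ = 0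

RP : Poly
RP a b c d = if (a ≡ᵇ 0) ∧ (b ≡ᵇ 1) ∧ (c ≡ᵇ 0) ∧ (d ≡ᵇ 0) then 1 else 0

Z : ℕ → ℕ → ℕ → ℕ → Poly
Z n l i j a b c d =
  count (λ A → isASTZ n l A ∧ inIJ n l i j A
               ∧ (μ A ≡ᵇ a) ∧ (rStat n l A ≡ᵇ b)
               ∧ (pStat n l A ≡ᵇ c) ∧ (qStat n l A ≡ᵇ d))
        (arrays n l)

{-# OPTIONS --safe #-}
module Submission where

-- If j < n, the column labelled n meets only the top row and is a 1-column, while no top-row entry
-- can be −1 since each heads its column; so the top row is 0…01. Deleting it is a bijection onto
-- ASTZ^{i,j}_{n−1,l} preserving all statistics, except that column −n (just a 0) would have to be
-- the 1-column when i = n, in which case Z vanishes. If j = n and i ≥ 2, the bottom row meets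
-- column −1 (a 0-column), the l − 2 central columns (sum 0) and column 1 (a 1-column), which
-- again forces 0…01; deleting it yields an (n−1, l+2)-ASTZ in which −1 and 1 have become central
-- columns. For n = 1 the only candidate is the row 10…0. Induction on n then gives (1), and also
-- Z(n,l;i,j) = 0 for i > n, which is what (2) needs when i = n.

open import Defs
open import Data.Nat using (ℕ; zero; suc; _+_; _*_; _∸_; _≤_; _<_; _⊓_; _≡ᵇ_; _<ᵇ_; z≤n; s≤s)
open import Data.Nat.Properties
open import Data.Nat.Tactic.RingSolver using (solve-∀)
open import Data.Bool using (Bool; true; false; _∧_; not; if_then_else_; T)
open import Data.Bool.Properties using (∧-idempotentCommutativeMonoid; ∧-zeroʳ; ∧-identityʳ; ∧-assoc; ∧-conicalˡ; ∧-conicalʳ; not-involutive)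
open import Data.Bool.ListAction using (and)
open import Data.List using (List; []; _∷_; [_]; map; concatMap; concat; length; upTo; applyUpTo; replicate; _++_; _∷ʳ_)
open import Data.List.Properties using (map-upTo; map-∘; map-cong; applyUpTo-∷ʳ; length-replicate; length-map; length-upTo; concat-++; ++-identityʳ)
open import Data.List.Relation.Unary.All using (All; []; _∷_) renaming (map to All-map)
open import Data.List.Relation.Unary.All.Properties using (++⁺; map⁺)
open import Data.Product using (_×_; _,_; proj₁; proj₂)
open import Data.Sum using (inj₁; inj₂)
open import Data.Empty using (⊥-elim)
open import Data.Integer as ℤ using (ℤ)
import Data.Integer.Properties as ℤP
open import Function using (_∘_; id)
open import Relation.Nullary using (¬_; yes; no)
open import Relation.Binary.PropositionalEquality hiding ([_])
import Algebra.Solver.IdempotentCommutativeMonoid as ∧-Solver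
open ∧-Solver ∧-idempotentCommutativeMonoid using (solve; _⊜_; _⊕_)

indicator : Bool → ℕ
indicator true = 1
indicator false = 0

sumBy : {A : Set} → (A → ℕ) → List A → ℕ
sumBy f [] = 0
sumBy f (x ∷ xs) = f x + sumBy f xs

module _ {A : Set} where

  count-∷ : (p : A → Bool) (x : A) (xs : List A) → count p (x ∷ xs) ≡ indicator (p x) + count p xs
  count-∷ p x xs with p x
  ... | true = refl
  ... | false = refl

  count-as-sumBy : (p : A → Bool) (xs : List A) → count p xs ≡ sumBy (indicator ∘ p) xs
  count-as-sumBy p [] = refl
  count-as-sumBy p (x ∷ xs) = trans (count-∷ p x xs) (cong (indicator (p x) +_) (count-as-sumBy p xs))

  count-++ : (p : A → Bool) (xs ys : List A) → count p (xs ++ ys) ≡ count p xs + count p ys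
  count-++ p [] ys = refl
  count-++ p (x ∷ xs) ys = begin
      count p (x ∷ xs ++ ys)                        ≡⟨ count-∷ p x (xs ++ ys) ⟩
      indicator (p x) + count p (xs ++ ys)          ≡⟨ cong (indicator (p x) +_) (count-++ p xs ys) ⟩
      indicator (p x) + (count p xs + count p ys)   ≡⟨ +-assoc (indicator (p x)) _ _ ⟨
      indicator (p x) + count p xs + count p ys     ≡⟨ cong (_+ count p ys) (count-∷ p x xs) ⟨
      count p (x ∷ xs) + count p ys                 ∎
    where open ≡-Reasoning

  sumBy-cong : {f g : A → ℕ} (xs : List A) → (∀ x → f x ≡ g x) → sumBy f xs ≡ sumBy g xs
  sumBy-cong [] h = refl
  sumBy-cong (x ∷ xs) h = cong₂ _+_ (h x) (sumBy-cong xs h)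

  sumBy-congᴬ : {P : A → Set} {f g : A → ℕ} {xs : List A} → All P xs →
    (∀ {x} → P x → f x ≡ g x) → sumBy f xs ≡ sumBy g xs
  sumBy-congᴬ [] h = refl
  sumBy-congᴬ (px ∷ pxs) h = cong₂ _+_ (h px) (sumBy-congᴬ pxs h)

  sumBy-zero : {f : A → ℕ} (xs : List A) → (∀ x → f x ≡ 0) → sumBy f xs ≡ 0
  sumBy-zero [] h = refl
  sumBy-zero (x ∷ xs) h = cong₂ _+_ (h x) (sumBy-zero xs h)

  sumBy-++ : (f : A → ℕ) (xs ys : List A) → sumBy f (xs ++ ys) ≡ sumBy f xs + sumBy f ys
  sumBy-++ f [] ys = refl
  sumBy-++ f (x ∷ xs) ys = trans (cong (f x +_) (sumBy-++ f xs ys)) (sym (+-assoc (f x) _ _))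

module _ {A B : Set} where

  count-map : (p : A → Bool) (q : B → Bool) (f : A → B) (xs : List A) →
    (∀ x → p x ≡ q (f x)) → count p xs ≡ count q (map f xs)
  count-map p q f [] h = refl
  count-map p q f (x ∷ xs) h = begin
      count p (x ∷ xs)                        ≡⟨ count-∷ p x xs ⟩
      indicator (p x) + count p xs            ≡⟨ cong₂ _+_ (cong indicator (h x)) (count-map p q f xs h) ⟩
      indicator (q (f x)) + count q (map f xs) ≡⟨ count-∷ q (f x) _ ⟨
      count q (map f (x ∷ xs))                ∎
    where open ≡-Reasoning

  sumBy-map : (f : B → ℕ) (g : A → B) (xs : List A) → sumBy f (map g xs) ≡ sumBy (f ∘ g) xs
  sumBy-map f g [] = refl
  sumBy-map f g (x ∷ xs) = cong (f (g x) +_) (sumBy-map f g xs)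

  sumBy-concatMap : (f : B → ℕ) (g : A → List B) (xs : List A) →
    sumBy f (concatMap g xs) ≡ sumBy (sumBy f ∘ g) xs
  sumBy-concatMap f g [] = refl
  sumBy-concatMap f g (x ∷ xs) =
    trans (sumBy-++ f (g x) (concatMap g xs)) (cong (sumBy f (g x) +_) (sumBy-concatMap f g xs))

module _ {A : Set} where

  seqs-length : (Xs : List (List A)) → All (λ B → length B ≡ length Xs) (seqs Xs)
  seqs-length [] = refl ∷ []
  seqs-length (X ∷ Xs) = go X
    where
    go : (Y : List A) → All (λ B → length B ≡ suc (length Xs)) (concatMap (λ x → map (x ∷_) (seqs Xs)) Y)
    go [] = []
    go (y ∷ Y) = ++⁺ (map⁺ (All-map (cong suc) (seqs-length Xs))) (go Y)

  sumBy-seqs-∷ : (h : List A → ℕ) (X : List A) (Xs : List (List A)) →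
    sumBy h (seqs (X ∷ Xs)) ≡ sumBy (λ x → sumBy (h ∘ (x ∷_)) (seqs Xs)) X
  sumBy-seqs-∷ h X Xs =
    trans (sumBy-concatMap h _ X) (sumBy-cong X (λ x → sumBy-map h (x ∷_) (seqs Xs)))

  sumBy-seqs-∷ʳ : (h : List A → ℕ) (Xs : List (List A)) (X : List A) →
    sumBy h (seqs (Xs ∷ʳ X)) ≡ sumBy (λ B → sumBy (λ w → h (B ∷ʳ w)) X) (seqs Xs)
  sumBy-seqs-∷ʳ h [] X =
    trans (sumBy-seqs-∷ h X []) (trans (sumBy-cong X (λ x → +-identityʳ (h [ x ]))) (sym (+-identityʳ _)))
  sumBy-seqs-∷ʳ h (Y ∷ Xs) X = begin
      sumBy h (seqs (Y ∷ Xs ∷ʳ X))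
    ≡⟨ sumBy-seqs-∷ h Y (Xs ∷ʳ X) ⟩
      sumBy (λ y → sumBy (h ∘ (y ∷_)) (seqs (Xs ∷ʳ X))) Y
    ≡⟨ sumBy-cong Y (λ y → sumBy-seqs-∷ʳ (h ∘ (y ∷_)) Xs X) ⟩
      sumBy (λ y → sumBy (λ B → sumBy (λ w → h (y ∷ B ∷ʳ w)) X) (seqs Xs)) Y
    ≡⟨ sumBy-seqs-∷ _ Y Xs ⟨
      sumBy (λ B → sumBy (λ w → h (B ∷ʳ w)) X) (seqs (Y ∷ Xs))
    ∎
    where open ≡-Reasoning

words-length : ∀ k → All (λ w → length w ≡ k) (words k)
words-length zero = refl ∷ []
words-length (suc k) = go (words k) (words-length k)
  where
  go : (ws : List (List E)) → All (λ w → length w ≡ k) ws →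
       All (λ w → length w ≡ suc k) (concatMap (λ w → map (_∷ w) (m1 ∷ z0 ∷ p1 ∷ [])) ws)
  go [] [] = []
  go (w ∷ ws) (e ∷ es) = cong suc e ∷ cong suc e ∷ cong suc e ∷ go ws es

-- words k lists every word of length k exactly once.
sumBy-words-at : (t : List E) (g : List E → ℕ) →
  (∀ w → length w ≡ length t → w ≢ t → g w ≡ 0) → sumBy g (words (length t)) ≡ g t
sumBy-words-at [] g supp = +-identityʳ (g [])
sumBy-words-at (x ∷ t) g supp = begin
    sumBy g (words (length (x ∷ t)))
  ≡⟨ sumBy-concatMap g _ (words (length t)) ⟩
    sumBy (λ w → g (m1 ∷ w) + (g (z0 ∷ w) + (g (p1 ∷ w) + 0))) (words (length t))
  ≡⟨ sumBy-congᴬ (words-length (length t)) only ⟩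
    sumBy (g ∘ (x ∷_)) (words (length t))
  ≡⟨ sumBy-words-at t (g ∘ (x ∷_)) (λ w len w≢t → supp (x ∷ w) (cong suc len) (w≢t ∘ proj₂ ∘ ∷-inj)) ⟩
    g (x ∷ t)
  ∎
  where
  open ≡-Reasoning
  ∷-inj : ∀ {y v} → y ∷ v ≡ x ∷ t → y ≡ x × v ≡ t
  ∷-inj refl = refl , refl
  off : ∀ {y w} → length w ≡ length t → y ≢ x → g (y ∷ w) ≡ 0
  off len y≢x = supp _ (cong suc len) (y≢x ∘ proj₁ ∘ ∷-inj)
  only : ∀ {w} → length w ≡ length t → g (m1 ∷ w) + (g (z0 ∷ w) + (g (p1 ∷ w) + 0)) ≡ g (x ∷ w)
  only = pick x off
    where
    pick : ∀ y → (∀ {z w} → length w ≡ length t → z ≢ y → g (z ∷ w) ≡ 0) →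
      ∀ {w} → length w ≡ length t → g (m1 ∷ w) + (g (z0 ∷ w) + (g (p1 ∷ w) + 0)) ≡ g (y ∷ w)
    pick m1 off {w} len =
      trans (cong (g (m1 ∷ w) +_) (cong₂ (λ a b → a + (b + 0)) (off len (λ ())) (off len (λ ())))) (+-identityʳ _)
    pick z0 off {w} len =
      trans (cong₂ (λ a b → a + (g (z0 ∷ w) + (b + 0))) (off len (λ ())) (off len (λ ()))) (+-identityʳ _)
    pick p1 off {w} len =
      trans (cong₂ (λ a b → a + (b + (g (p1 ∷ w) + 0))) (off len (λ ())) (off len (λ ()))) (+-identityʳ _)

false≢true : false ≢ true
false≢true ()

≡ᵇ-false : ∀ m n → m ≢ n → (m ≡ᵇ n) ≡ false
≡ᵇ-false m n m≢n with m ≡ᵇ n in e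
... | false = refl
... | true = ⊥-elim (m≢n (≡ᵇ⇒≡ m n (subst T (sym e) _)))

m+n<ᵇm≡false : ∀ m n → (m + n <ᵇ m) ≡ false
m+n<ᵇm≡false zero n = refl
m+n<ᵇm≡false (suc m) n = m+n<ᵇm≡false m n

≡ᵇ-refl : ∀ n → (n ≡ᵇ n) ≡ true
≡ᵇ-refl zero = refl
≡ᵇ-refl (suc n) = ≡ᵇ-refl n

≡ᵇ-comm : ∀ m n → (m ≡ᵇ n) ≡ (n ≡ᵇ m)
≡ᵇ-comm zero zero = refl
≡ᵇ-comm zero (suc n) = refl
≡ᵇ-comm (suc m) zero = refl
≡ᵇ-comm (suc m) (suc n) = ≡ᵇ-comm m n

indicator-if : ∀ x → indicator x ≡ (if x then 1 else 0)
indicator-if true = refl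
indicator-if false = refl

allBelow : (ℕ → Bool) → ℕ → Bool
allBelow f zero = true
allBelow f (suc k) = f 0 ∧ allBelow (f ∘ suc) k

countBelow : (ℕ → Bool) → ℕ → ℕ
countBelow f zero = 0
countBelow f (suc k) = indicator (f 0) + countBelow (f ∘ suc) k

and-applyUpTo : (f : ℕ → Bool) (k : ℕ) → and (applyUpTo f k) ≡ allBelow f k
and-applyUpTo f zero = refl
and-applyUpTo f (suc k) = cong (f 0 ∧_) (and-applyUpTo (f ∘ suc) k)

count-applyUpTo : (f : ℕ → Bool) (k : ℕ) → count id (applyUpTo f k) ≡ countBelow f k
count-applyUpTo f zero = refl
count-applyUpTo f (suc k) = trans (count-∷ id (f 0) _) (cong (indicator (f 0) +_) (count-applyUpTo (f ∘ suc) k))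

map-upTo-shift : {B : Set} (F : ℕ → B) (a k : ℕ) → map F (map (a +_) (upTo k)) ≡ applyUpTo (λ x → F (a + x)) k
map-upTo-shift F a k = trans (sym (map-∘ (upTo k))) (map-upTo (λ x → F (a + x)) k)

allL-range1 : (g : ℕ → Bool) (k : ℕ) → allL g (range1 k) ≡ allBelow (g ∘ suc) k
allL-range1 g k = trans (cong and (map-upTo-shift g 1 k)) (and-applyUpTo (g ∘ suc) k)

allL-rangeFT : (g : ℕ → Bool) (a b : ℕ) → allL g (rangeFT a b) ≡ allBelow (λ x → g (a + x)) (suc b ∸ a)
allL-rangeFT g a b = trans (cong and (map-upTo-shift g a (suc b ∸ a))) (and-applyUpTo _ (suc b ∸ a))

count-range1 : (g : ℕ → Bool) (k : ℕ) → count g (range1 k) ≡ countBelow (g ∘ suc) k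
count-range1 g k = begin
    count g (range1 k)               ≡⟨ count-map g id g (range1 k) (λ _ → refl) ⟩
    count id (map g (range1 k))      ≡⟨ cong (count id) (map-upTo-shift g 1 k) ⟩
    count id (applyUpTo (g ∘ suc) k) ≡⟨ count-applyUpTo (g ∘ suc) k ⟩
    countBelow (g ∘ suc) k           ∎
  where open ≡-Reasoning

allBelow-suc : (f : ℕ → Bool) (k : ℕ) → allBelow f (suc k) ≡ allBelow f k ∧ f k
allBelow-suc f zero = ∧-identityʳ (f 0)
allBelow-suc f (suc k) = trans (cong (f 0 ∧_) (allBelow-suc (f ∘ suc) k)) (sym (∧-assoc (f 0) _ _))

allBelow-+ : (f : ℕ → Bool) (a b : ℕ) → allBelow f (a + b) ≡ allBelow f a ∧ allBelow (λ y → f (a + y)) b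
allBelow-+ f zero b = refl
allBelow-+ f (suc a) b = trans (cong (f 0 ∧_) (allBelow-+ (f ∘ suc) a b)) (sym (∧-assoc (f 0) _ _))

countBelow-suc : (f : ℕ → Bool) (k : ℕ) → countBelow f (suc k) ≡ countBelow f k + indicator (f k)
countBelow-suc f zero = +-comm (indicator (f 0)) 0
countBelow-suc f (suc k) =
  trans (cong (indicator (f 0) +_) (countBelow-suc (f ∘ suc) k)) (sym (+-assoc (indicator (f 0)) _ _))

allBelow-cong : (f g : ℕ → Bool) (k : ℕ) → (∀ c → c < k → f c ≡ g c) → allBelow f k ≡ allBelow g k
allBelow-cong f g zero h = refl
allBelow-cong f g (suc k) h =
  cong₂ _∧_ (h 0 (s≤s z≤n)) (allBelow-cong (f ∘ suc) (g ∘ suc) k (λ c lt → h (suc c) (s≤s lt)))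

countBelow-cong : (f g : ℕ → Bool) (k : ℕ) → (∀ c → c < k → f c ≡ g c) → countBelow f k ≡ countBelow g k
countBelow-cong f g zero h = refl
countBelow-cong f g (suc k) h =
  cong₂ _+_ (cong indicator (h 0 (s≤s z≤n))) (countBelow-cong (f ∘ suc) (g ∘ suc) k (λ c lt → h (suc c) (s≤s lt)))

allBelow-at : (f : ℕ → Bool) (k : ℕ) → allBelow f k ≡ true → ∀ c → c < k → f c ≡ true
allBelow-at f (suc k) all zero lt = ∧-conicalˡ _ _ all
allBelow-at f (suc k) all (suc c) (s≤s lt) = allBelow-at (f ∘ suc) k (∧-conicalʳ _ _ all) c lt

allBelow-intro : (f : ℕ → Bool) (k : ℕ) → (∀ c → c < k → f c ≡ true) → allBelow f k ≡ true
allBelow-intro f zero h = refl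
allBelow-intro f (suc k) h = cong₂ _∧_ (h 0 (s≤s z≤n)) (allBelow-intro (f ∘ suc) k (λ c lt → h (suc c) (s≤s lt)))

columnOK : List E → Bool
columnOK xs = alternates xs ∧ headIsPosOrEmpty (nonzeros xs)

-- Reading a column top to bottom, its partial sums must stay in {0, 1}.
data ColState : Set where
  sum0 sum1 broken : ColState

scan : ColState → List E → ColState
scan broken _ = broken
scan s [] = s
scan s (z0 ∷ xs) = scan s xs
scan sum0 (p1 ∷ xs) = scan sum1 xs
scan sum0 (m1 ∷ xs) = broken
scan sum1 (m1 ∷ xs) = scan sum0 xs
scan sum1 (p1 ∷ xs) = broken

alive : ColState → Bool
alive broken = false
alive _ = true

stateValue : ColState → ℤ
stateValue sum1 = ℤ.1ℤ
stateValue _ = ℤ.0ℤ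

alternatingNZ-after-p1 : ∀ xs → alternatingNZ (p1 ∷ nonzeros xs) ≡ alive (scan sum1 xs)
alternatingNZ-after-m1 : ∀ xs → alternatingNZ (m1 ∷ nonzeros xs) ≡ alive (scan sum0 xs)
alternatingNZ-after-p1 [] = refl
alternatingNZ-after-p1 (z0 ∷ xs) = alternatingNZ-after-p1 xs
alternatingNZ-after-p1 (p1 ∷ xs) = refl
alternatingNZ-after-p1 (m1 ∷ xs) = alternatingNZ-after-m1 xs
alternatingNZ-after-m1 [] = refl
alternatingNZ-after-m1 (z0 ∷ xs) = alternatingNZ-after-m1 xs
alternatingNZ-after-m1 (p1 ∷ xs) = alternatingNZ-after-p1 xs
alternatingNZ-after-m1 (m1 ∷ xs) = refl

columnOK-scan : ∀ xs → columnOK xs ≡ alive (scan sum0 xs)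
columnOK-scan [] = refl
columnOK-scan (z0 ∷ xs) = columnOK-scan xs
columnOK-scan (p1 ∷ xs) = trans (∧-identityʳ _) (alternatingNZ-after-p1 xs)
columnOK-scan (m1 ∷ xs) = ∧-zeroʳ _

scan-++ : ∀ s xs ys → scan s (xs ++ ys) ≡ scan (scan s xs) ys
scan-++ broken xs ys = refl
scan-++ sum0 [] ys = refl
scan-++ sum1 [] ys = refl
scan-++ sum0 (z0 ∷ xs) ys = scan-++ sum0 xs ys
scan-++ sum1 (z0 ∷ xs) ys = scan-++ sum1 xs ys
scan-++ sum0 (p1 ∷ xs) ys = scan-++ sum1 xs ys
scan-++ sum0 (m1 ∷ xs) ys = refl
scan-++ sum1 (m1 ∷ xs) ys = scan-++ sum0 xs ys
scan-++ sum1 (p1 ∷ xs) ys = refl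

sumE-++ : ∀ xs ys → sumE (xs ++ ys) ≡ sumE xs ℤ.+ sumE ys
sumE-++ [] ys = sym (ℤP.+-identityˡ _)
sumE-++ (x ∷ xs) ys = trans (cong (λ z → val x ℤ.+ z) (sumE-++ xs ys)) (sym (ℤP.+-assoc (val x) _ _))

sumE-z0 : ∀ xs → sumE (z0 ∷ xs) ≡ sumE xs
sumE-z0 xs = ℤP.+-identityˡ (sumE xs)

sumE-scan : ∀ s xs → alive (scan s xs) ≡ true → stateValue s ℤ.+ sumE xs ≡ stateValue (scan s xs)
sumE-scan sum0 [] _ = refl
sumE-scan sum1 [] _ = refl
sumE-scan sum0 (z0 ∷ xs) ok = trans (cong (λ z → ℤ.0ℤ ℤ.+ z) (sumE-z0 xs)) (sumE-scan sum0 xs ok)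
sumE-scan sum1 (z0 ∷ xs) ok = trans (cong (λ z → ℤ.1ℤ ℤ.+ z) (sumE-z0 xs)) (sumE-scan sum1 xs ok)
sumE-scan sum0 (p1 ∷ xs) ok = trans (ℤP.+-identityˡ _) (sumE-scan sum1 xs ok)
sumE-scan sum1 (m1 ∷ xs) ok = begin
    ℤ.1ℤ ℤ.+ (ℤ.-1ℤ ℤ.+ sumE xs)   ≡⟨ ℤP.+-assoc ℤ.1ℤ ℤ.-1ℤ (sumE xs) ⟨
    ℤ.0ℤ ℤ.+ sumE xs               ≡⟨ sumE-scan sum0 xs ok ⟩
    stateValue (scan sum0 xs)      ∎
  where open ≡-Reasoning

==ℤ-sound : ∀ x y → (x ==ℤ y) ≡ true → x ≡ y
==ℤ-sound x y e with x ℤ.≟ y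
... | yes x≡y = x≡y

columnOK-sum : ∀ xs → columnOK xs ≡ true → sumE xs ≡ stateValue (scan sum0 xs)
columnOK-sum xs ok =
  trans (sym (ℤP.+-identityˡ (sumE xs))) (sumE-scan sum0 xs (trans (sym (columnOK-scan xs)) ok))

columnOK-∷ʳ-z0 : ∀ xs → columnOK (xs ∷ʳ z0) ≡ columnOK xs
columnOK-∷ʳ-z0 xs = begin
    columnOK (xs ∷ʳ z0)              ≡⟨ columnOK-scan (xs ∷ʳ z0) ⟩
    alive (scan sum0 (xs ∷ʳ z0))     ≡⟨ cong alive (scan-++ sum0 xs [ z0 ]) ⟩
    alive (scan (scan sum0 xs) [ z0 ]) ≡⟨ cong alive (scan-z0 (scan sum0 xs)) ⟩
    alive (scan sum0 xs)             ≡⟨ columnOK-scan xs ⟨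
    columnOK xs                      ∎
  where
  open ≡-Reasoning
  scan-z0 : ∀ s → scan s [ z0 ] ≡ s
  scan-z0 sum0 = refl
  scan-z0 sum1 = refl
  scan-z0 broken = refl

sumE-∷ʳ-z0 : ∀ xs → sumE (xs ∷ʳ z0) ≡ sumE xs
sumE-∷ʳ-z0 xs = trans (sumE-++ xs [ z0 ]) (ℤP.+-identityʳ (sumE xs))

zeroSum≡not-oneSum : ∀ xs → columnOK xs ≡ true → (sumE xs ==ℤ ℤ.0ℤ) ≡ not (sumE xs ==ℤ ℤ.1ℤ)
zeroSum≡not-oneSum xs ok rewrite columnOK-sum xs ok with scan sum0 xs
... | sum0 = refl
... | sum1 = refl
... | broken = refl

columnOK-∷ʳ-p1 : ∀ xs → columnOK (xs ∷ʳ p1) ≡ columnOK xs ∧ (sumE xs ==ℤ ℤ.0ℤ)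
columnOK-∷ʳ-p1 xs =
  trans (columnOK-scan (xs ∷ʳ p1)) (trans (cong alive (scan-++ sum0 xs [ p1 ])) (by-state (scan sum0 xs) refl))
  where
  by-state : ∀ s → scan sum0 xs ≡ s → alive (scan s [ p1 ]) ≡ columnOK xs ∧ (sumE xs ==ℤ ℤ.0ℤ)
  by-state sum0 e rewrite columnOK-scan xs | e | columnOK-sum xs (trans (columnOK-scan xs) (cong alive e)) | e = refl
  by-state sum1 e rewrite columnOK-scan xs | e | columnOK-sum xs (trans (columnOK-scan xs) (cong alive e)) | e = refl
  by-state broken e rewrite columnOK-scan xs | e = refl

oneSum-∷ʳ-p1 : ∀ xs → (sumE (xs ∷ʳ p1) ==ℤ ℤ.1ℤ) ≡ (sumE xs ==ℤ ℤ.0ℤ)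
oneSum-∷ʳ-p1 xs = trans (cong (_==ℤ ℤ.1ℤ) (sumE-++ xs [ p1 ])) (plus1 (sumE xs))
  where
  plus1 : ∀ s → ((s ℤ.+ ℤ.1ℤ) ==ℤ ℤ.1ℤ) ≡ (s ==ℤ ℤ.0ℤ)
  plus1 (ℤ.+ zero) = refl
  plus1 (ℤ.+ suc n) rewrite +-comm n 1 = refl
  plus1 ℤ.-[1+ zero ] = refl
  plus1 ℤ.-[1+ suc n ] = refl

columnOK-∷ʳ-p1⇒oneSum : ∀ xs → columnOK (xs ∷ʳ p1) ≡ true → (sumE (xs ∷ʳ p1) ==ℤ ℤ.1ℤ) ≡ true
columnOK-∷ʳ-p1⇒oneSum xs ok =
  trans (oneSum-∷ʳ-p1 xs) (∧-conicalʳ (columnOK xs) _ (trans (sym (columnOK-∷ʳ-p1 xs)) ok))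

columnOK-∷ʳ-m1⇒¬oneSum : ∀ xs → columnOK (xs ∷ʳ m1) ≡ true → (sumE (xs ∷ʳ m1) ==ℤ ℤ.1ℤ) ≡ false
columnOK-∷ʳ-m1⇒¬oneSum xs ok rewrite columnOK-sum (xs ∷ʳ m1) ok | scan-++ sum0 xs [ m1 ] with scan sum0 xs
... | sum0 = refl
... | sum1 = refl
... | broken = refl

unitRow : ℕ → List E
unitRow K = replicate K z0 ∷ʳ p1

unitRow-ok : ∀ K → (alternates (unitRow K) ∧ (sumE (unitRow K) ==ℤ ℤ.1ℤ)) ≡ true
unitRow-ok zero = refl
unitRow-ok (suc K) rewrite sumE-z0 (unitRow K) = unitRow-ok K

length-unitRow : ∀ K → length (unitRow K) ≡ suc K
length-unitRow zero = refl
length-unitRow (suc K) = cong suc (length-unitRow K)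

nth-unitRow-< : ∀ K c → c < K → nth z0 (unitRow K) c ≡ z0
nth-unitRow-< (suc K) zero _ = refl
nth-unitRow-< (suc K) (suc c) (s≤s lt) = nth-unitRow-< K c lt

nth-unitRow-last : ∀ K → nth z0 (unitRow K) K ≡ p1
nth-unitRow-last zero = refl
nth-unitRow-last (suc K) = nth-unitRow-last K

μ-unitRow : ∀ K → count isNeg (unitRow K) ≡ 0
μ-unitRow zero = refl
μ-unitRow (suc K) = μ-unitRow K

replicate-z0 : ∀ k v → length v ≡ k → (∀ x → x < k → nth z0 v x ≡ z0) → v ≡ replicate k z0
replicate-z0 zero [] _ _ = refl
replicate-z0 (suc k) (e ∷ v) len h =
  cong₂ _∷_ (h 0 (s≤s z≤n)) (replicate-z0 k v (suc-injective len) (λ x lt → h (suc x) (s≤s lt)))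

sumE-replicate-z0 : ∀ k → sumE (replicate k z0) ≡ ℤ.0ℤ
sumE-replicate-z0 zero = refl
sumE-replicate-z0 (suc k) = trans (sumE-z0 (replicate k z0)) (sumE-replicate-z0 k)

NoEntry : E → List E → ℕ → Set
NoEntry e w k = ∀ c → c < k → nth z0 w c ≢ e

-- Without −1 entries an alternating row has at most one 1.
unitRow-from-top : ∀ K w → length w ≡ suc K → NoEntry m1 w (suc K) → nth z0 w K ≡ p1 →
  alternates w ≡ true → w ≡ unitRow K
unitRow-from-top K (m1 ∷ w) len no-m1 last alt = ⊥-elim (no-m1 0 (s≤s z≤n) refl)
unitRow-from-top zero (z0 ∷ []) len no-m1 () alt
unitRow-from-top (suc K) (z0 ∷ w) len no-m1 last alt =
  cong (z0 ∷_) (unitRow-from-top K w (suc-injective len) (λ c lt → no-m1 (suc c) (s≤s lt)) last alt)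
unitRow-from-top zero (p1 ∷ []) len no-m1 last alt = refl
unitRow-from-top (suc K) (p1 ∷ w) len no-m1 last alt =
  ⊥-elim (no-p1 w (suc-injective len) (λ c lt → no-m1 (suc c) (s≤s lt))
           (trans (sym (alternatingNZ-after-p1 w)) alt) last)
  where
  no-p1 : ∀ {K} w → length w ≡ suc K → NoEntry m1 w (suc K) → alive (scan sum1 w) ≡ true → nth z0 w K ≢ p1
  no-p1 (m1 ∷ w) len no-m1 ok _ = no-m1 0 (s≤s z≤n) refl
  no-p1 {zero} (z0 ∷ w) len no-m1 ok ()
  no-p1 {suc K} (z0 ∷ w) len no-m1 ok = no-p1 w (suc-injective len) (λ c lt → no-m1 (suc c) (s≤s lt)) ok
  no-p1 (p1 ∷ w) len no-m1 () _

-- Entries other than 1 contribute at most 0 to the sum, so the sum 1 forces all but the last to vanish.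
unitRow-from-bottom : ∀ K w → length w ≡ suc K → NoEntry p1 w K → nth z0 w K ≢ m1 →
  sumE w ≡ ℤ.1ℤ → w ≡ unitRow K
unitRow-from-bottom zero (m1 ∷ []) len no-p1 last s = ⊥-elim (last refl)
unitRow-from-bottom zero (z0 ∷ []) len no-p1 last ()
unitRow-from-bottom zero (p1 ∷ []) len no-p1 last s = refl
unitRow-from-bottom (suc K) (p1 ∷ w) len no-p1 last s = ⊥-elim (no-p1 0 (s≤s z≤n) refl)
unitRow-from-bottom (suc K) (z0 ∷ w) len no-p1 last s =
  cong (z0 ∷_) (unitRow-from-bottom K w (suc-injective len) (λ c lt → no-p1 (suc c) (s≤s lt)) last
                  (trans (sym (sumE-z0 w)) s))
unitRow-from-bottom (suc K) (m1 ∷ w) len no-p1 last s = ⊥-elim (1≰0 (begin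
    ℤ.1ℤ                   ≡⟨ s ⟨
    ℤ.-1ℤ ℤ.+ sumE w       ≤⟨ ℤP.+-monoʳ-≤ ℤ.-1ℤ (sum≤1 K w (suc-injective len) (λ c lt → no-p1 (suc c) (s≤s lt))) ⟩
    ℤ.0ℤ                   ∎))
  where
  open ℤP.≤-Reasoning
  1≰0 : ¬ (ℤ.1ℤ ℤ.≤ ℤ.0ℤ)
  1≰0 (ℤ.+≤+ ())
  val≤1 : ∀ e → val e ℤ.≤ ℤ.1ℤ
  val≤1 m1 = ℤ.-≤+
  val≤1 z0 = ℤ.+≤+ z≤n
  val≤1 p1 = ℤ.+≤+ (s≤s z≤n)
  val≤0 : ∀ e → e ≢ p1 → val e ℤ.≤ ℤ.0ℤ
  val≤0 m1 _ = ℤ.-≤+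
  val≤0 z0 _ = ℤ.+≤+ z≤n
  val≤0 p1 e≢p1 = ⊥-elim (e≢p1 refl)
  sum≤1 : ∀ K w → length w ≡ suc K → NoEntry p1 w K → sumE w ℤ.≤ ℤ.1ℤ
  sum≤1 zero (e ∷ []) len no-p1 = subst (ℤ._≤ ℤ.1ℤ) (sym (ℤP.+-identityʳ (val e))) (val≤1 e)
  sum≤1 (suc K) (e ∷ w) len no-p1 =
    ℤP.+-mono-≤ (val≤0 e (no-p1 0 (s≤s z≤n))) (sum≤1 K w (suc-injective len) (λ c lt → no-p1 (suc c) (s≤s lt)))

+-suc-suc : ∀ a b → a + suc (suc b) ≡ suc (suc (a + b))
+-suc-suc a b = trans (+-suc a (suc b)) (cong suc (+-suc a b))

numCols-eq : ∀ m l' → numCols m (suc (suc l')) ≡ 2 * m + l'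
numCols-eq m l' = cong (_∸ 2) (+-suc-suc (2 * m) l')

numCols-suc : ∀ m l' → numCols (suc m) (suc (suc l')) ≡ suc (suc (2 * m + l'))
numCols-suc m l' = trans (cong (λ z → z + suc (suc l') ∸ 2) (*-suc 2 m)) (+-suc-suc (2 * m) l')

colHeight-suc : ∀ m l' c → c ≤ suc (2 * m + l') →
  colHeight (suc m) (suc (suc l')) (suc c) ≡ suc (colHeight m (suc (suc l')) c)
colHeight-suc m l' c le =
  trans (cong (λ z → suc (m ⊓ c) ⊓ z) distance-to-end)
        (cong (λ z → suc ((m ⊓ c) ⊓ z)) (sym (cong (λ z → z ∸ 1 ∸ c) (+-suc-suc (2 * m) l'))))
  where
  distance-to-end : 2 * suc m + suc (suc l') ∸ 1 ∸ suc c ≡ suc (suc (2 * m + l') ∸ c)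
  distance-to-end = trans (cong (λ z → z + suc (suc l') ∸ 1 ∸ suc c) (*-suc 2 m))
     (trans (cong (_∸ c) (+-suc-suc (2 * m) l')) (+-∸-assoc 1 le))

colHeight-0 : ∀ m l → colHeight m l 0 ≡ 0
colHeight-0 m l = cong (_⊓ (2 * m + l ∸ 1 ∸ 0)) (⊓-zeroʳ m)

colHeight-end : ∀ m l' → colHeight m (suc (suc l')) (suc (2 * m + l')) ≡ 0
colHeight-end m l' = trans (cong (m ⊓ suc (2 * m + l') ⊓_)
  (trans (cong (λ z → z ∸ 1 ∸ suc (2 * m + l')) (+-suc-suc (2 * m) l')) (n∸n≡0 (suc (2 * m + l'))))) (⊓-zeroʳ _)

centralCount : ∀ m l' → suc (m + suc (suc l') ∸ 2) ∸ suc m ≡ l'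
centralCount m l' = trans (cong (λ z → suc (z ∸ 2) ∸ suc m) (+-suc-suc m l')) (m+n∸m≡n m l')

central<width : ∀ m l' x → x < l' → suc m + x ≤ 2 * m + l'
central<width m l' x lt = subst (_≤ 2 * m + l') (+-suc m x) (+-mono-≤ (m≤m+n m (m + 0)) lt)

leftCol-suc : ∀ m x → x ≤ m → leftCol (suc m) (suc x) ≡ suc (leftCol m (suc x))
leftCol-suc m x le = +-∸-assoc 1 le

leftCol≤width : ∀ m l' x → leftCol m (suc x) ≤ 2 * m + l'
leftCol≤width m l' x = ≤-trans (m∸n≤m m x) (≤-trans (m≤m+n m (m + 0)) (m≤m+n (m + (m + 0)) l'))

rightCol-eq : ∀ m l' x → rightCol m (suc (suc l')) x ≡ m + l' + x
rightCol-eq m l' x = cong (λ z → z ∸ 2 + x) (+-suc-suc m l')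

rightCol-suc : ∀ m l' x → rightCol (suc m) (suc (suc l')) x ≡ suc (rightCol m (suc (suc l')) x)
rightCol-suc m l' x = trans (rightCol-eq (suc m) l' x) (cong suc (sym (rightCol-eq m l' x)))

rightCol≤width : ∀ m l' x → x < m → rightCol m (suc (suc l')) (suc x) ≤ 2 * m + l'
rightCol≤width m l' x lt = begin
    rightCol m (suc (suc l')) (suc x)  ≡⟨ rightCol-eq m l' (suc x) ⟩
    m + l' + suc x                     ≤⟨ +-monoʳ-≤ (m + l') lt ⟩
    m + l' + m                         ≡⟨ rearrange m l' ⟩
    2 * m + l'                         ∎
  where
  open ≤-Reasoning
  rearrange : ∀ m l' → m + l' + m ≡ 2 * m + l'
  rearrange = solve-∀

rightCol-last : ∀ m l' → rightCol m (suc (suc l')) (suc m) ≡ suc (2 * m + l')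
rightCol-last m l' = trans (rightCol-eq m l' (suc m)) (rearrange m l')
  where
  rearrange : ∀ m l' → m + l' + suc m ≡ suc (2 * m + l')
  rearrange = solve-∀

applyUpTo-cong< : {A : Set} {f g : ℕ → A} (k : ℕ) → (∀ x → x < k → f x ≡ g x) → applyUpTo f k ≡ applyUpTo g k
applyUpTo-cong< zero h = refl
applyUpTo-cong< (suc k) h = cong₂ _∷_ (h 0 (s≤s z≤n)) (applyUpTo-cong< k (λ x lt → h (suc x) (s≤s lt)))

topEntries : Array → ℕ → ℕ → List E
topEntries A h c = applyUpTo (λ k → entry A (suc k) c) h

column-topEntries : ∀ n l A c → column n l A c ≡ topEntries A (colHeight n l c) c
column-topEntries n l A c = map-upTo-shift (λ r → entry A r c) 1 (colHeight n l c)

rowsOK : Array → Bool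
rowsOK A = allL (λ row → alternates row ∧ (sumE row ==ℤ ℤ.1ℤ)) A

columnsOK : ℕ → ℕ → Array → Bool
columnsOK n l A = allL (λ c → columnOK (column n l A c)) (range1 (numCols n l))

centralZero : ℕ → ℕ → Array → Bool
centralZero n l A = allL (λ c → sumE (column n l A c) ==ℤ ℤ.0ℤ) (rangeFT (suc n) (n + l ∸ 2))

leftOK : ℕ → ℕ → ℕ → Array → Bool
leftOK n l i A = allL (λ i' → isOneCol n l A (leftCol n i') ==B (i' ≡ᵇ i)) (range1 n)

rightOK : ℕ → ℕ → ℕ → Array → Bool
rightOK n l j A = allL (λ j' → not (isOneCol n l A (rightCol n l j')) ==B (j' ≡ᵇ j)) (range1 n)

contributes : ℕ → ℕ → ℕ → ℕ → ℕ → ℕ → ℕ → ℕ → Array → Bool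
contributes n l i j a b c d A = isASTZ n l A ∧ inIJ n l i j A
  ∧ (μ A ≡ᵇ a) ∧ (rStat n l A ≡ᵇ b) ∧ (pStat n l A ≡ᵇ c) ∧ (qStat n l A ≡ᵇ d)

Z-as-sumBy : ∀ n l i j a b c d →
  Z n l i j a b c d ≡ sumBy (indicator ∘ contributes n l i j a b c d) (arrays n l)
Z-as-sumBy n l i j a b c d = count-as-sumBy (contributes n l i j a b c d) (arrays n l)

module Contributing (n l i j a b c d : ℕ) (A : Array) (ok : contributes n l i j a b c d A ≡ true) where

  isASTZ-true : isASTZ n l A ≡ true
  isASTZ-true = ∧-conicalˡ (isASTZ n l A) _ ok

  inIJ-true : inIJ n l i j A ≡ true
  inIJ-true = ∧-conicalˡ (inIJ n l i j A) _ (∧-conicalʳ (isASTZ n l A) _ ok)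

  rowsOK-true : rowsOK A ≡ true
  rowsOK-true = ∧-conicalˡ (rowsOK A) _ isASTZ-true

  columnsOK-true : columnsOK n l A ≡ true
  columnsOK-true = ∧-conicalˡ (columnsOK n l A) _ (∧-conicalʳ (rowsOK A) _ isASTZ-true)

  centralZero-true : centralZero n l A ≡ true
  centralZero-true = ∧-conicalʳ (columnsOK n l A) _ (∧-conicalʳ (rowsOK A) _ isASTZ-true)

  leftOK-true : leftOK n l i A ≡ true
  leftOK-true = ∧-conicalˡ (leftOK n l i A) _ inIJ-true

  rightOK-true : rightOK n l j A ≡ true
  rightOK-true = ∧-conicalʳ (leftOK n l i A) _ inIJ-true

columnOK-at : ∀ n l A → columnsOK n l A ≡ true → ∀ c → c < numCols n l → columnOK (column n l A (suc c)) ≡ true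
columnOK-at n l A ok = allBelow-at _ (numCols n l) (trans (sym (allL-range1 _ (numCols n l))) ok)

rightOK-at : ∀ n l j A → rightOK n l j A ≡ true → ∀ x → x < n →
  (not (isOneCol n l A (rightCol n l (suc x))) ==B (suc x ≡ᵇ j)) ≡ true
rightOK-at n l j A ok = allBelow-at _ n (trans (sym (allL-range1 _ n)) ok)

centralZero-at : ∀ n l' A → centralZero n (suc (suc l')) A ≡ true → ∀ x → x < l' →
  (sumE (column n (suc (suc l')) A (suc n + x)) ==ℤ ℤ.0ℤ) ≡ true
centralZero-at n l' A ok = allBelow-at _ l'
  (trans (cong (allBelow (λ x → sumE (column n (suc (suc l')) A (suc n + x)) ==ℤ ℤ.0ℤ)) (sym (centralCount n l')))
    (trans (sym (allL-rangeFT (λ c → sumE (column n (suc (suc l')) A c) ==ℤ ℤ.0ℤ) (suc n) (n + suc (suc l') ∸ 2))) ok))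

leftOK-at : ∀ n l i A → leftOK n l i A ≡ true → ∀ x → x < n →
  (isOneCol n l A (leftCol n (suc x)) ==B (suc x ≡ᵇ i)) ≡ true
leftOK-at n l i A ok = allBelow-at _ n (trans (sym (allL-range1 _ n)) ok)

==B-true : ∀ x → (x ==B true) ≡ x
==B-true true = refl
==B-true false = refl

==B-false : ∀ x → (x ==B false) ≡ not x
==B-false true = refl
==B-false false = refl

arrays-suc : ∀ m l → arrays (suc m) l ≡ seqs (words (rowLen (suc m) l 1) ∷ map (λ r → words (rowLen m l r)) (range1 m))
arrays-suc m l = cong (λ rows → seqs (W 1 ∷ rows)) (begin
    map W (map suc (applyUpTo suc m))   ≡⟨ cong (map W ∘ map suc) (map-upTo suc m) ⟨
    map W (map suc (map suc (upTo m)))  ≡⟨ map-∘ (map suc (upTo m)) ⟨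
    map (W ∘ suc) (map suc (upTo m))    ≡⟨ map-∘ (upTo m) ⟨
    map (W ∘ suc ∘ suc) (upTo m)        ≡⟨ map-cong (λ x → cong words (rowLen-suc x)) (upTo m) ⟩
    map (W' ∘ suc) (upTo m)             ≡⟨ map-∘ (upTo m) ⟩
    map W' (map suc (upTo m))           ∎)
  where
  open ≡-Reasoning
  W W' : ℕ → List (List E)
  W r = words (rowLen (suc m) l r)
  W' r = words (rowLen m l r)
  rowLen-suc : ∀ x → rowLen (suc m) l (suc (suc x)) ≡ rowLen m l (suc x)
  rowLen-suc x = cong₂ (λ a b → a + l ∸ b) (*-suc 2 m) (*-suc 2 (suc x))

module TopRow (m l' : ℕ) where

  l K : ℕ
  l = suc (suc l')
  K = 2 * m + l'

  t : List E
  t = unitRow (suc K)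

  column-∷ : ∀ w B c → c ≤ suc K → column (suc m) l (w ∷ B) (suc c) ≡ nth z0 w c ∷ column m l B c
  column-∷ w B c le = begin
      column (suc m) l (w ∷ B) (suc c)                     ≡⟨ column-topEntries (suc m) l (w ∷ B) (suc c) ⟩
      topEntries (w ∷ B) (colHeight (suc m) l (suc c)) (suc c) ≡⟨ cong (λ h → topEntries (w ∷ B) h (suc c)) (colHeight-suc m l' c le) ⟩
      nth z0 w c ∷ topEntries B (colHeight m l c) c          ≡⟨ cong (nth z0 w c ∷_) (column-topEntries m l B c) ⟨
      nth z0 w c ∷ column m l B c                          ∎
    where open ≡-Reasoning

  column-empty : ∀ B c → colHeight m l c ≡ 0 → column m l B c ≡ []
  column-empty B c h0 = trans (column-topEntries m l B c) (cong (λ h → topEntries B h c) h0)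

  bottomEntry-∷ : ∀ w B c → c ≤ suc K → bottomEntry (suc m) l (w ∷ B) (suc c) ≡
     (if colHeight m l c ≡ᵇ 0 then nth z0 w c else bottomEntry m l B c)
  bottomEntry-∷ w B c le rewrite colHeight-suc m l' c le with colHeight m l c
  ... | zero = refl
  ... | suc h = refl

  nth-t-< : ∀ c → c ≤ K → nth z0 t c ≡ z0
  nth-t-< c le = nth-unitRow-< (suc K) c (s≤s le)

  column-t∷ : ∀ B c → c ≤ K → column (suc m) l (t ∷ B) (suc c) ≡ z0 ∷ column m l B c
  column-t∷ B c le = trans (column-∷ t B c (m≤n⇒m≤1+n le)) (cong (_∷ column m l B c) (nth-t-< c le))

  isOneCol-t∷ : ∀ B c → c ≤ K → isOneCol (suc m) l (t ∷ B) (suc c) ≡ isOneCol m l B c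
  isOneCol-t∷ B c le = cong (_==ℤ ℤ.1ℤ) (trans (cong sumE (column-t∷ B c le)) (sumE-z0 (column m l B c)))

  isTenCol-t∷ : ∀ B c → c ≤ K → isTenCol (suc m) l (t ∷ B) (suc c) ≡ isTenCol m l B c
  isTenCol-t∷ B c le rewrite isOneCol-t∷ B c le | bottomEntry-∷ t B c (m≤n⇒m≤1+n le) | nth-t-< c le =
    by-height (colHeight m l c) refl
    where
    by-height : ∀ h → colHeight m l c ≡ h →
      isOneCol m l B c ∧ isZero (if h ≡ᵇ 0 then z0 else bottomEntry m l B c) ≡ isTenCol m l B c
    by-height zero h0 rewrite column-empty B c h0 = refl
    by-height (suc h) _ = refl

  isOneCol-0 : ∀ B → isOneCol m l B 0 ≡ false
  isOneCol-0 B rewrite column-empty B 0 (colHeight-0 m l) = refl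

  isTenCol-0 : ∀ B → isTenCol m l B 0 ≡ false
  isTenCol-0 B = cong (_∧ isZero (bottomEntry m l B 0)) (isOneCol-0 B)

  column-t∷-last : ∀ B → column (suc m) l (t ∷ B) (suc (suc K)) ≡ [ p1 ]
  column-t∷-last B rewrite column-∷ t B (suc K) ≤-refl | nth-unitRow-last (suc K)
                         | column-empty B (suc K) (colHeight-end m l') = refl

  isOneCol-t∷-last : ∀ B → isOneCol (suc m) l (t ∷ B) (suc (suc K)) ≡ true
  isOneCol-t∷-last B rewrite column-t∷-last B = refl

  isTenCol-t∷-last : ∀ B → isTenCol (suc m) l (t ∷ B) (suc (suc K)) ≡ false
  isTenCol-t∷-last B rewrite isOneCol-t∷-last B | bottomEntry-∷ t B (suc K) ≤-refl
                           | colHeight-end m l' | nth-unitRow-last (suc K) = refl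

  rowsOK-t∷ : ∀ B → rowsOK (t ∷ B) ≡ rowsOK B
  rowsOK-t∷ B = cong (_∧ rowsOK B) (unitRow-ok (suc K))

  columnsOK-t∷ : ∀ B → columnsOK (suc m) l (t ∷ B) ≡ columnsOK m l B
  columnsOK-t∷ B
    rewrite numCols-suc m l' | numCols-eq m l'
          | allL-range1 (λ c → columnOK (column (suc m) l (t ∷ B) c)) (suc (suc K))
          | allL-range1 (λ c → columnOK (column m l B c)) K
          | allBelow-suc (λ c → columnOK (column (suc m) l (t ∷ B) (suc (suc c)))) K
          | column-t∷ B 0 z≤n | column-empty B 0 (colHeight-0 m l) | column-t∷-last B
    = trans (∧-identityʳ _) (allBelow-cong _ _ K (λ c lt → cong columnOK (column-t∷ B (suc c) lt)))

  centralZero-t∷ : ∀ B → centralZero (suc m) l (t ∷ B) ≡ centralZero m l B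
  centralZero-t∷ B
    rewrite allL-rangeFT (λ c → sumE (column (suc m) l (t ∷ B) c) ==ℤ ℤ.0ℤ) (suc (suc m)) (suc m + l ∸ 2)
          | allL-rangeFT (λ c → sumE (column m l B c) ==ℤ ℤ.0ℤ) (suc m) (m + l ∸ 2)
          | centralCount (suc m) l' | centralCount m l'
    = allBelow-cong _ _ l' (λ x lt → cong (_==ℤ ℤ.0ℤ)
        (trans (cong sumE (column-t∷ B (suc m + x) (central<width m l' x lt))) (sumE-z0 (column m l B (suc m + x)))))

  isASTZ-t∷ : ∀ B → isASTZ (suc m) l (t ∷ B) ≡ isASTZ m l B
  isASTZ-t∷ B rewrite rowsOK-t∷ B | columnsOK-t∷ B | centralZero-t∷ B = refl

  isOneCol-t∷-left : ∀ B x → x < m → isOneCol (suc m) l (t ∷ B) (leftCol (suc m) (suc x)) ≡ isOneCol m l B (leftCol m (suc x))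
  isOneCol-t∷-left B x lt = trans (cong (isOneCol (suc m) l (t ∷ B)) (leftCol-suc m x (<⇒≤ lt)))
                                  (isOneCol-t∷ B (leftCol m (suc x)) (leftCol≤width m l' x))

  isOneCol-t∷-right : ∀ B x → x < m → isOneCol (suc m) l (t ∷ B) (rightCol (suc m) l (suc x)) ≡ isOneCol m l B (rightCol m l (suc x))
  isOneCol-t∷-right B x lt = trans (cong (isOneCol (suc m) l (t ∷ B)) (rightCol-suc m l' (suc x)))
                                   (isOneCol-t∷ B (rightCol m l (suc x)) (rightCol≤width m l' x lt))

  -- The leftmost column (label −(m+1)) of t ∷ B contains only the top entry 0.
  leftOK-t∷ : ∀ B i → leftOK (suc m) l i (t ∷ B) ≡ leftOK m l i B ∧ not (suc m ≡ᵇ i)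
  leftOK-t∷ B i
    rewrite allL-range1 (λ i' → isOneCol (suc m) l (t ∷ B) (leftCol (suc m) i') ==B (i' ≡ᵇ i)) (suc m)
          | allL-range1 (λ i' → isOneCol m l B (leftCol m i') ==B (i' ≡ᵇ i)) m
          | allBelow-suc (λ x → isOneCol (suc m) l (t ∷ B) (leftCol (suc m) (suc x)) ==B (suc x ≡ᵇ i)) m
          | leftCol-suc m m ≤-refl | n∸n≡0 m | isOneCol-t∷ B 0 z≤n | isOneCol-0 B
    = cong (_∧ not (suc m ≡ᵇ i)) (allBelow-cong _ _ m (λ x lt →
        cong (_==B (suc x ≡ᵇ i)) (isOneCol-t∷-left B x lt)))

  -- The rightmost column (label m+1) of t ∷ B contains only the top entry 1.
  rightOK-t∷ : ∀ B j → j ≤ m → rightOK (suc m) l j (t ∷ B) ≡ rightOK m l j B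
  rightOK-t∷ B j le
    rewrite allL-range1 (λ j' → not (isOneCol (suc m) l (t ∷ B) (rightCol (suc m) l j')) ==B (j' ≡ᵇ j)) (suc m)
          | allL-range1 (λ j' → not (isOneCol m l B (rightCol m l j')) ==B (j' ≡ᵇ j)) m
          | allBelow-suc (λ x → not (isOneCol (suc m) l (t ∷ B) (rightCol (suc m) l (suc x))) ==B (suc x ≡ᵇ j)) m
          | rightCol-suc m l' (suc m) | rightCol-last m l' | isOneCol-t∷-last B
          | ≡ᵇ-false (suc m) j (λ e → 1+n≰n (subst (_≤ m) (sym e) le))
    = trans (∧-identityʳ _) (allBelow-cong _ _ m (λ x lt →
        cong (λ z → not z ==B (suc x ≡ᵇ j)) (isOneCol-t∷-right B x lt)))

  inIJ-t∷ : ∀ B i j → j ≤ m → inIJ (suc m) l i j (t ∷ B) ≡ not (suc m ≡ᵇ i) ∧ inIJ m l i j B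
  inIJ-t∷ B i j le rewrite leftOK-t∷ B i | rightOK-t∷ B j le = shuffle (leftOK m l i B) (rightOK m l j B) (suc m ≡ᵇ i)
    where
    shuffle : ∀ x y n → (x ∧ not n) ∧ y ≡ not n ∧ (x ∧ y)
    shuffle true y true = refl
    shuffle true y false = refl
    shuffle false y n = sym (∧-zeroʳ (not n))

  μ-t∷ : ∀ B → μ (t ∷ B) ≡ μ B
  μ-t∷ B = trans (count-++ isNeg t (concat B)) (cong (_+ μ B) (μ-unitRow (suc K)))

  rStat-t∷ : ∀ B → rStat (suc m) l (t ∷ B) ≡ rStat m l B
  rStat-t∷ B
    rewrite count-range1 (λ i → isOneCol (suc m) l (t ∷ B) (leftCol (suc m) i)) (suc m)
          | count-range1 (λ i → isOneCol m l B (leftCol m i)) m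
          | countBelow-suc (λ x → isOneCol (suc m) l (t ∷ B) (leftCol (suc m) (suc x))) m
          | leftCol-suc m m ≤-refl | n∸n≡0 m | isOneCol-t∷ B 0 z≤n | isOneCol-0 B
    = trans (+-identityʳ _) (countBelow-cong _ _ m (isOneCol-t∷-left B))

  pStat-t∷ : ∀ B → pStat (suc m) l (t ∷ B) ≡ pStat m l B
  pStat-t∷ B
    rewrite count-range1 (λ i → isTenCol (suc m) l (t ∷ B) (leftCol (suc m) i)) (suc m)
          | count-range1 (λ i → isTenCol m l B (leftCol m i)) m
          | countBelow-suc (λ x → isTenCol (suc m) l (t ∷ B) (leftCol (suc m) (suc x))) m
          | leftCol-suc m m ≤-refl | n∸n≡0 m | isTenCol-t∷ B 0 z≤n | isTenCol-0 B
    = trans (+-identityʳ _) (countBelow-cong _ _ m (λ x lt →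
        trans (cong (isTenCol (suc m) l (t ∷ B)) (leftCol-suc m x (<⇒≤ lt)))
              (isTenCol-t∷ B (leftCol m (suc x)) (leftCol≤width m l' x))))

  qStat-t∷ : ∀ B → qStat (suc m) l (t ∷ B) ≡ qStat m l B
  qStat-t∷ B
    rewrite count-range1 (λ j → isTenCol (suc m) l (t ∷ B) (rightCol (suc m) l j)) (suc m)
          | count-range1 (λ j → isTenCol m l B (rightCol m l j)) m
          | countBelow-suc (λ x → isTenCol (suc m) l (t ∷ B) (rightCol (suc m) l (suc x))) m
          | rightCol-suc m l' (suc m) | rightCol-last m l' | isTenCol-t∷-last B
    = trans (+-identityʳ _) (countBelow-cong _ _ m (λ x lt →
        trans (cong (isTenCol (suc m) l (t ∷ B)) (rightCol-suc m l' (suc x)))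
              (isTenCol-t∷ B (rightCol m l (suc x)) (rightCol≤width m l' x lt))))

  contributes-t∷ : ∀ i j a b c d B → j ≤ m →
    contributes (suc m) l i j a b c d (t ∷ B) ≡ not (suc m ≡ᵇ i) ∧ contributes m l i j a b c d B
  contributes-t∷ i j a b c d B le
    rewrite isASTZ-t∷ B | inIJ-t∷ B i j le | μ-t∷ B | rStat-t∷ B | pStat-t∷ B | qStat-t∷ B
    with suc m ≡ᵇ i
  ... | true = ∧-zeroʳ _
  ... | false = refl

  -- Every top-row entry is the topmost entry of its column, so it is not −1; the rightmost
  -- column (label m+1) is a 1-column consisting of the top entry alone.
  topRow-forced : ∀ i j a b c d w B → j ≤ m → length w ≡ suc (suc K) →
    contributes (suc m) l i j a b c d (w ∷ B) ≡ true → w ≡ t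
  topRow-forced i j a b c d w B le len ok =
    unitRow-from-top (suc K) w len no-m1 last-p1 (∧-conicalˡ _ _ (∧-conicalˡ _ _ rowsOK-true))
    where
    open Contributing (suc m) l i j a b c d (w ∷ B) ok
    columnsOK-w∷B : ∀ c → c < suc (suc K) → columnOK (column (suc m) l (w ∷ B) (suc c)) ≡ true
    columnsOK-w∷B c lt = columnOK-at (suc m) l (w ∷ B) columnsOK-true c
                           (subst (c <_) (sym (numCols-suc m l')) lt)
    no-m1 : NoEntry m1 w (suc (suc K))
    no-m1 c lt e = false≢true (subst (λ b → b ≡ true) (trans (cong columnOK column-m1) (∧-zeroʳ _)) (columnsOK-w∷B c lt))
      where
      column-m1 : column (suc m) l (w ∷ B) (suc c) ≡ m1 ∷ column m l B c
      column-m1 = trans (column-∷ w B c (≤-pred lt)) (cong (_∷ column m l B c) e)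
    last-column : column (suc m) l (w ∷ B) (rightCol (suc m) l (suc m)) ≡ [ nth z0 w (suc K) ]
    last-column = trans (cong (column (suc m) l (w ∷ B)) (trans (rightCol-suc m l' (suc m)) (cong suc (rightCol-last m l'))))
                    (trans (column-∷ w B (suc K) ≤-refl) (cong (nth z0 w (suc K) ∷_) (column-empty B (suc K) (colHeight-end m l'))))
    last-isOne : isOneCol (suc m) l (w ∷ B) (rightCol (suc m) l (suc m)) ≡ true
    last-isOne = trans (sym (not-involutive _)) (trans (sym (==B-false _))
      (subst (λ b → (not (isOneCol (suc m) l (w ∷ B) (rightCol (suc m) l (suc m))) ==B b) ≡ true)
             (≡ᵇ-false (suc m) j (λ e → 1+n≰n (subst (_≤ m) (sym e) le)))
             (rightOK-at (suc m) l j (w ∷ B) rightOK-true m ≤-refl)))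
    last-p1 : nth z0 w (suc K) ≡ p1
    last-p1 = single-one (nth z0 w (suc K)) (trans (cong (λ xs → sumE xs ==ℤ ℤ.1ℤ) (sym last-column)) last-isOne)
      where
      single-one : ∀ e → (sumE [ e ] ==ℤ ℤ.1ℤ) ≡ true → e ≡ p1
      single-one p1 _ = refl

  Z-top-row : ∀ i j a b c d → j ≤ m →
    Z (suc m) l i j a b c d ≡ sumBy (λ B → indicator (not (suc m ≡ᵇ i) ∧ contributes m l i j a b c d B)) (arrays m l)
  Z-top-row i j a b c d le = begin
      Z (suc m) l i j a b c d
    ≡⟨ Z-as-sumBy (suc m) l i j a b c d ⟩
      sumBy (indicator ∘ P) (arrays (suc m) l)
    ≡⟨ cong (sumBy (indicator ∘ P)) (arrays-suc m l) ⟩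
      sumBy (indicator ∘ P) (seqs (words (rowLen (suc m) l 1) ∷ lowerRows))
    ≡⟨ sumBy-seqs-∷ (indicator ∘ P) (words (rowLen (suc m) l 1)) lowerRows ⟩
      sumBy g (words (rowLen (suc m) l 1))
    ≡⟨ cong (λ k → sumBy g (words k)) (trans (numCols-suc m l') (sym (length-unitRow (suc K)))) ⟩
      sumBy g (words (length t))
    ≡⟨ sumBy-words-at t g (λ w len w≢t → sumBy-zero (arrays m l) (λ B → off w B len w≢t)) ⟩
      g t
    ≡⟨ sumBy-cong (arrays m l) (λ B → cong indicator (contributes-t∷ i j a b c d B le)) ⟩
      sumBy (λ B → indicator (not (suc m ≡ᵇ i) ∧ contributes m l i j a b c d B)) (arrays m l)
    ∎
    where
    open ≡-Reasoning
    P : Array → Bool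
    P = contributes (suc m) l i j a b c d
    lowerRows : List (List (List E))
    lowerRows = map (λ r → words (rowLen m l r)) (range1 m)
    g : List E → ℕ
    g w = sumBy (λ B → indicator (P (w ∷ B))) (arrays m l)
    off : ∀ w B → length w ≡ length t → w ≢ t → indicator (P (w ∷ B)) ≡ 0
    off w B len w≢t with P (w ∷ B) in ok
    ... | false = refl
    ... | true = ⊥-elim (w≢t (topRow-forced i j a b c d w B le (trans len (length-unitRow (suc K))) ok))

≈P-trans : {f g h : Poly} → f ≈P g → g ≈P h → f ≈P h
≈P-trans f≈g g≈h a b c d = trans (f≈g a b c d) (g≈h a b c d)

Z-top-row-≢ : ∀ m l' i j → j ≤ m → suc m ≢ i → Z (suc m) (suc (suc l')) i j ≈P Z m (suc (suc l')) i j
Z-top-row-≢ m l' i j le ne a b c d = trans (TopRow.Z-top-row m l' i j a b c d le)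
  (trans (sumBy-cong (arrays m (suc (suc l'))) (λ B → cong (λ z → indicator (not z ∧ contributes m (suc (suc l')) i j a b c d B))
    (≡ᵇ-false (suc m) i ne))) (sym (Z-as-sumBy m (suc (suc l')) i j a b c d)))

Z-top-row-≡ : ∀ m l' j → j ≤ m → Z (suc m) (suc (suc l')) (suc m) j ≈P 0P
Z-top-row-≡ m l' j le a b c d = trans (TopRow.Z-top-row m l' (suc m) j a b c d le)
  (sumBy-zero (arrays m (suc (suc l'))) (λ B → cong (λ z → indicator (not z ∧ contributes m (suc (suc l')) (suc m) j a b c d B)) (≡ᵇ-refl m)))

-- Column −1 of B ∷ʳ t is a central column of B: the 0-column condition (not o1) on it becomes the
-- zero-sum condition z1, which is equivalent for a valid column (C1).
reshuffle : ∀ R C1 g z2 C3 M o1 z1 LB RB Sᴬ Sᴮ → (C1 ≡ true → z1 ≡ not o1) → not o1 ∧ Sᴬ ≡ not o1 ∧ Sᴮ →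
  (R ∧ (C1 ∧ (g ∧ z2) ∧ C3) ∧ M) ∧ ((not o1 ∧ LB) ∧ (z2 ∧ RB)) ∧ Sᴬ
  ≡ (R ∧ (C1 ∧ g ∧ C3) ∧ (z1 ∧ M ∧ z2)) ∧ (LB ∧ RB) ∧ Sᴮ
reshuffle R C1 g z2 C3 M o1 z1 LB RB Sᴬ Sᴮ z1≡ stats = begin
    (R ∧ (C1 ∧ (g ∧ z2) ∧ C3) ∧ M) ∧ ((n ∧ LB) ∧ (z2 ∧ RB)) ∧ Sᴬ
  ≡⟨ solve 10 (λ R C1 g z2 C3 M n LB RB S →
       ((R ⊕ (C1 ⊕ (g ⊕ z2) ⊕ C3) ⊕ M) ⊕ ((n ⊕ LB) ⊕ (z2 ⊕ RB)) ⊕ S)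
       ⊜ (((n ⊕ C1) ⊕ (n ⊕ S)) ⊕ R ⊕ g ⊕ z2 ⊕ C3 ⊕ M ⊕ LB ⊕ RB)) refl R C1 g z2 C3 M n LB RB Sᴬ ⟩
    ((n ∧ C1) ∧ (n ∧ Sᴬ)) ∧ rest
  ≡⟨ cong (λ s → ((n ∧ C1) ∧ s) ∧ rest) stats ⟩
    ((n ∧ C1) ∧ (n ∧ Sᴮ)) ∧ rest
  ≡⟨ solve 4 (λ n C1 S rest → (((n ⊕ C1) ⊕ (n ⊕ S)) ⊕ rest) ⊜ (((n ⊕ C1) ⊕ S) ⊕ rest)) refl n C1 Sᴮ rest ⟩
    ((n ∧ C1) ∧ Sᴮ) ∧ rest
  ≡⟨ cong (λ s → (s ∧ Sᴮ) ∧ rest) (n∧C1 C1 z1≡) ⟩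
    ((z1 ∧ C1) ∧ Sᴮ) ∧ rest
  ≡⟨ solve 10 (λ R C1 g z2 C3 M z1 LB RB S → 
       (((z1 ⊕ C1) ⊕ S) ⊕ R ⊕ g ⊕ z2 ⊕ C3 ⊕ M ⊕ LB ⊕ RB)
       ⊜ ((R ⊕ (C1 ⊕ g ⊕ C3) ⊕ (z1 ⊕ M ⊕ z2)) ⊕ (LB ⊕ RB) ⊕ S)) refl R C1 g z2 C3 M z1 LB RB Sᴮ ⟩
    (R ∧ (C1 ∧ g ∧ C3) ∧ (z1 ∧ M ∧ z2)) ∧ (LB ∧ RB) ∧ Sᴮ
  ∎
  where
  open ≡-Reasoning
  n rest : Bool
  n = not o1
  rest = R ∧ g ∧ z2 ∧ C3 ∧ M ∧ LB ∧ RB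
  n∧C1 : ∀ C1 → (C1 ≡ true → z1 ≡ n) → n ∧ C1 ≡ z1 ∧ C1
  n∧C1 true z1≡ rewrite z1≡ refl = refl
  n∧C1 false _ = trans (∧-zeroʳ n) (sym (∧-zeroʳ z1))

-- An (m+1, l)-array A = B ∷ʳ w compared with the (m, l+2)-array B: both have the same
-- columns, those of A in positions m+1, …, m+l being one entry longer.
module BottomRow (m l' : ℕ) where

  l : ℕ
  l = suc (suc l')

  width-shift : 2 * suc m + l ≡ 2 * m + (l + 2)
  width-shift = shift m l'
    where
    shift : ∀ m l' → 2 * suc m + suc (suc l') ≡ 2 * m + (suc (suc l') + 2)
    shift = solve-∀

  numCols-shift : numCols (suc m) l ≡ numCols m (l + 2)
  numCols-shift = cong (_∸ 2) width-shift

  numCols-split : numCols (suc m) l ≡ (m + suc l') + suc m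
  numCols-split = cong (_∸ 2) (split m l')
    where
    split : ∀ m l' → 2 * suc m + suc (suc l') ≡ suc (suc ((m + suc l') + suc m))
    split = solve-∀

  rowLen-shift : ∀ r → rowLen (suc m) l r ≡ rowLen m (l + 2) r
  rowLen-shift r = cong (_∸ 2 * r) width-shift

  rowLen-last : rowLen (suc m) l (suc m) ≡ l
  rowLen-last = m+n∸m≡n (2 * suc m) l

  distance-shift : ∀ c → 2 * suc m + l ∸ 1 ∸ c ≡ 2 * m + (l + 2) ∸ 1 ∸ c
  distance-shift c = cong (λ z → z ∸ 1 ∸ c) width-shift

  distance-middle : ∀ x → 2 * suc m + l ∸ 1 ∸ (suc m + x) ≡ (suc m + suc l') ∸ x
  distance-middle x = trans (cong (λ z → z ∸ 1 ∸ (suc m + x)) (e m l')) ([m+n]∸[m+o]≡n∸o (suc m) (suc m + suc l') x)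
    where
    e : ∀ m l' → 2 * suc m + suc (suc l') ≡ suc (suc m + (suc m + suc l'))
    e = solve-∀

  distance-middle-≥ : ∀ x → x ≤ suc l' → suc m ≤ 2 * suc m + l ∸ 1 ∸ (suc m + x)
  distance-middle-≥ x le = subst (suc m ≤_) (sym (trans (distance-middle x) (+-∸-assoc (suc m) le))) (m≤m+n (suc m) _)

  distance-right-≤ : ∀ y → 2 * suc m + l ∸ 1 ∸ (suc m + (l + y)) ≤ m
  distance-right-≤ y = begin
      2 * suc m + l ∸ 1 ∸ (suc m + (l + y))  ≡⟨ distance-middle (l + y) ⟩
      suc m + suc l' ∸ (l + y)               ≤⟨ ∸-monoʳ-≤ (suc m + suc l') (m≤m+n l y) ⟩
      suc m + suc l' ∸ l                     ≡⟨ cong (_∸ l) (e m l') ⟩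
      m + l ∸ l                              ≡⟨ m+n∸n≡m m l ⟩
      m                                      ∎
    where
    open ≤-Reasoning
    e : ∀ m l' → suc m + suc l' ≡ m + suc (suc l')
    e = solve-∀

  rightCol-1 : rightCol (suc m) l 1 ≡ suc m + suc l'
  rightCol-1 = trans (rightCol-eq (suc m) l' 1) (e m l')
    where
    e : ∀ m l' → suc m + l' + 1 ≡ suc m + suc l'
    e = solve-∀

  rightCol-shiftˡ : ∀ x → rightCol (suc m) l (suc (suc x)) ≡ suc m + (l + x)
  rightCol-shiftˡ x = trans (rightCol-eq (suc m) l' (suc (suc x))) (e m l' x)
    where
    e : ∀ m l' x → suc m + l' + suc (suc x) ≡ suc m + (suc (suc l') + x)
    e = solve-∀

  rightCol-shiftʳ : ∀ x → rightCol m (l + 2) (suc x) ≡ suc m + (l + x)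
  rightCol-shiftʳ x = trans (rightCol-eq m (l' + 2) (suc x)) (e m l' x)
    where
    e : ∀ m l' x → m + (l' + 2) + suc x ≡ suc m + (suc (suc l') + x)
    e = solve-∀

  centralCount-shift : suc (m + (l + 2) ∸ 2) ∸ suc m ≡ l
  centralCount-shift = trans (centralCount m (l' + 2)) (+-comm l' 2)

  upperRows : List (List (List E))
  upperRows = map (λ r → words (rowLen m (l + 2) r)) (range1 m)

  length-upperRows : length upperRows ≡ m
  length-upperRows = trans (length-map _ (range1 m)) (trans (length-map suc (upTo m)) (length-upTo m))

  arrays-snoc : arrays (suc m) l ≡ seqs (upperRows ∷ʳ words l)
  arrays-snoc = cong seqs (begin
      map W (range1 (suc m))                      ≡⟨ map-upTo-shift W 1 (suc m) ⟩
      applyUpTo (W ∘ suc) (suc m)                 ≡⟨ applyUpTo-∷ʳ (W ∘ suc) m ⟨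
      applyUpTo (W ∘ suc) m ∷ʳ W (suc m)          ≡⟨ cong₂ _∷ʳ_ (applyUpTo-cong< m (λ r _ → cong words (rowLen-shift (suc r))))
                                                                 (cong words rowLen-last) ⟩
      applyUpTo (W' ∘ suc) m ∷ʳ words l           ≡⟨ cong (_∷ʳ words l) (map-upTo-shift W' 1 m) ⟨
      upperRows ∷ʳ words l                        ∎)
    where
    open ≡-Reasoning
    W W' : ℕ → List (List E)
    W r = words (rowLen (suc m) l r)
    W' r = words (rowLen m (l + 2) r)

  module Snoc (B : Array) (w : List E) (lenB : length B ≡ m) where

    A : Array
    A = B ∷ʳ w

    SameColumn : ℕ → Set
    SameColumn c = column (suc m) l A c ≡ column m (l + 2) B c × bottomEntry (suc m) l A c ≡ bottomEntry m (l + 2) B c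

    entry-upper : ∀ k c → k ≤ m → entry A k c ≡ entry B k c
    entry-upper zero c _ = refl
    entry-upper (suc k) c le = cong (λ row → if c <ᵇ suc k then z0 else nth z0 row (c ∸ suc k))
       (nth-∷ʳ-< B k (subst (k <_) (sym lenB) le))
      where
      nth-∷ʳ-< : ∀ (C : Array) k → k < length C → nth [] (C ∷ʳ w) k ≡ nth [] C k
      nth-∷ʳ-< (r ∷ C) zero _ = refl
      nth-∷ʳ-< (r ∷ C) (suc k) (s≤s lt) = nth-∷ʳ-< C k lt

    entry-last : ∀ x → entry A (suc m) (suc m + x) ≡ nth z0 w x
    entry-last x rewrite m+n<ᵇm≡false (suc m) x | m+n∸m≡n (suc m) x =
      cong (λ row → nth z0 row x) (subst (λ k → nth [] A k ≡ w) lenB (nth-∷ʳ-length B))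
      where
      nth-∷ʳ-length : ∀ (C : Array) → nth [] (C ∷ʳ w) (length C) ≡ w
      nth-∷ʳ-length [] = refl
      nth-∷ʳ-length (r ∷ C) = nth-∷ʳ-length C

    topEntries-upper : ∀ h c → h ≤ m → topEntries A h c ≡ topEntries B h c
    topEntries-upper h c le = applyUpTo-cong< h (λ x lt → entry-upper (suc x) c (≤-trans lt le))

    same-column : ∀ c → colHeight (suc m) l c ≡ colHeight m (l + 2) c → colHeight m (l + 2) c ≤ m → SameColumn c
    same-column c same-height le =
        trans (column-topEntries (suc m) l A c) (trans (cong (λ h → topEntries A h c) same-height)
          (trans (topEntries-upper _ c le) (sym (column-topEntries m (l + 2) B c))))
      , trans (cong (λ h → entry A h c) same-height) (entry-upper _ c le)

    same-column-left : ∀ c → c ≤ m → SameColumn c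
    same-column-left c le = same-column c
      (cong₂ _⊓_ (trans (m≥n⇒m⊓n≡n (m≤n⇒m≤1+n le)) (sym (m≥n⇒m⊓n≡n le))) (distance-shift c))
      (≤-trans (m⊓n≤m _ _) (≤-trans (m⊓n≤n m c) le))

    same-column-right : ∀ y → SameColumn (suc m + (l + y))
    same-column-right y = same-column c
      (begin
        colHeight (suc m) l c                         ≡⟨ cong (_⊓ (2 * suc m + l ∸ 1 ∸ c)) (m≤n⇒m⊓n≡m (m≤m+n (suc m) (l + y))) ⟩
        suc m ⊓ (2 * suc m + l ∸ 1 ∸ c)               ≡⟨ m≥n⇒m⊓n≡n (m≤n⇒m≤1+n (distance-right-≤ y)) ⟩
        2 * suc m + l ∸ 1 ∸ c                         ≡⟨ m≥n⇒m⊓n≡n (distance-right-≤ y) ⟨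
        m ⊓ (2 * suc m + l ∸ 1 ∸ c)                   ≡⟨ cong₂ _⊓_ (m≤n⇒m⊓n≡m (≤-trans (n≤1+n m) (m≤m+n (suc m) (l + y)))) (sym (distance-shift c)) ⟨
        colHeight m (l + 2) c                         ∎)
      (≤-trans (m⊓n≤n _ _) (subst (_≤ m) (distance-shift c) (distance-right-≤ y)))
      where
      open ≡-Reasoning
      c : ℕ
      c = suc m + (l + y)

    height-middle : ∀ x → x ≤ suc l' → colHeight (suc m) l (suc m + x) ≡ suc m × colHeight m (l + 2) (suc m + x) ≡ m
    height-middle x le =
        trans (cong (_⊓ (2 * suc m + l ∸ 1 ∸ (suc m + x))) (m≤n⇒m⊓n≡m (m≤m+n (suc m) x))) (m≤n⇒m⊓n≡m (distance-middle-≥ x le))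
      , trans (cong (_⊓ (2 * m + (l + 2) ∸ 1 ∸ (suc m + x))) (m≤n⇒m⊓n≡m (≤-trans (n≤1+n m) (m≤m+n (suc m) x))))
              (m≤n⇒m⊓n≡m (≤-trans (n≤1+n m) (subst (suc m ≤_) (distance-shift (suc m + x)) (distance-middle-≥ x le))))

    column-middle : ∀ x → x ≤ suc l' → column (suc m) l A (suc m + x) ≡ column m (l + 2) B (suc m + x) ∷ʳ nth z0 w x
    column-middle x le = begin
        column (suc m) l A c                               ≡⟨ column-topEntries (suc m) l A c ⟩
        topEntries A (colHeight (suc m) l c) c             ≡⟨ cong (λ h → topEntries A h c) (proj₁ (height-middle x le)) ⟩
        topEntries A (suc m) c                             ≡⟨ applyUpTo-∷ʳ (λ k → entry A (suc k) c) m ⟨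
        topEntries A m c ∷ʳ entry A (suc m) c              ≡⟨ cong₂ _∷ʳ_ (topEntries-upper m c ≤-refl) (entry-last x) ⟩
        topEntries B m c ∷ʳ nth z0 w x                     ≡⟨ cong (λ h → topEntries B h c ∷ʳ nth z0 w x) (proj₂ (height-middle x le)) ⟨
        topEntries B (colHeight m (l + 2) c) c ∷ʳ nth z0 w x ≡⟨ cong (_∷ʳ nth z0 w x) (column-topEntries m (l + 2) B c) ⟨
        column m (l + 2) B c ∷ʳ nth z0 w x                 ∎
      where
      open ≡-Reasoning
      c : ℕ
      c = suc m + x

    bottomEntry-middle : ∀ x → x ≤ suc l' → bottomEntry (suc m) l A (suc m + x) ≡ nth z0 w x
    bottomEntry-middle x le = trans (cong (λ h → entry A h (suc m + x)) (proj₁ (height-middle x le))) (entry-last x)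

module BottomUnitRow (m0 l' i1 : ℕ) (B : Array) (lenB : length B ≡ suc m0) where

  m : ℕ
  m = suc m0
  open BottomRow m l'

  t : List E
  t = unitRow (suc l')

  open Snoc B t lenB

  -- Positions 1, …, x0 hold the left columns of A and its columns −1 and central; position x0 + 1
  -- is column 1 of A. In B, positions m + 1, …, x0 + 1 are the central columns.
  x0 : ℕ
  x0 = m + suc l'

  okA okB : ℕ → Bool
  okA c = columnOK (column (suc m) l A c)
  okB c = columnOK (column m (l + 2) B c)

  sumB : ℕ → ℤ
  sumB c = sumE (column m (l + 2) B c)

  okBefore okAt okAfter zeroFirst oneFirst zeroInner zeroLast : Bool
  okBefore = allBelow (okB ∘ suc) x0
  okAt = okB (suc x0)
  okAfter = allBelow (λ y → okB (suc (x0 + suc y))) m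
  zeroFirst = sumB (suc m) ==ℤ ℤ.0ℤ
  oneFirst = sumB (suc m) ==ℤ ℤ.1ℤ
  zeroInner = allBelow (λ x → sumB (suc m + suc x) ==ℤ ℤ.0ℤ) l'
  zeroLast = sumB (suc m + suc l') ==ℤ ℤ.0ℤ

  column-middle-z0 : ∀ x → x ≤ l' → column (suc m) l A (suc m + x) ≡ column m (l + 2) B (suc m + x) ∷ʳ z0
  column-middle-z0 x le =
    trans (column-middle x (m≤n⇒m≤1+n le)) (cong (column m (l + 2) B (suc m + x) ∷ʳ_) (nth-unitRow-< (suc l') x (s≤s le)))

  column-middle-p1 : column (suc m) l A (suc m + suc l') ≡ column m (l + 2) B (suc m + suc l') ∷ʳ p1
  column-middle-p1 = trans (column-middle (suc l') ≤-refl) (cong (column m (l + 2) B (suc m + suc l') ∷ʳ_) (nth-unitRow-last (suc l')))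

  okA-before : ∀ x → x < x0 → okA (suc x) ≡ okB (suc x)
  okA-before x lt with x <? m
  ... | yes x<m = cong columnOK (proj₁ (same-column-left (suc x) x<m))
  ... | no x≮m = begin
      okA (suc x)                                     ≡⟨ cong okA x≡ ⟩
      okA (suc m + (x ∸ m))                           ≡⟨ cong columnOK (column-middle-z0 (x ∸ m) x∸m≤l') ⟩
      columnOK (column m (l + 2) B (suc m + (x ∸ m)) ∷ʳ z0) ≡⟨ columnOK-∷ʳ-z0 (column m (l + 2) B (suc m + (x ∸ m))) ⟩
      okB (suc m + (x ∸ m))                           ≡⟨ cong okB x≡ ⟨
      okB (suc x)                                     ∎
    where
    open ≡-Reasoning
    m≤x : m ≤ x
    m≤x = ≮⇒≥ x≮m
    x≡ : suc x ≡ suc m + (x ∸ m)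
    x≡ = cong suc (sym (m+[n∸m]≡n m≤x))
    x∸m≤l' : x ∸ m ≤ l'
    x∸m≤l' = ≤-pred (subst (x ∸ m <_) (m+n∸m≡n m (suc l')) (∸-monoˡ-< lt m≤x))

  after-index : ∀ y → suc (x0 + suc y) ≡ suc m + (l + y)
  after-index y = e m l' y
    where
    e : ∀ m l' y → suc (m + suc l' + suc y) ≡ suc m + (suc (suc l') + y)
    e = solve-∀

  columnsOK-A : columnsOK (suc m) l A ≡ okBefore ∧ (okAt ∧ zeroLast) ∧ okAfter
  columnsOK-A = begin
      columnsOK (suc m) l A
    ≡⟨ allL-range1 okA (numCols (suc m) l) ⟩
      allBelow (okA ∘ suc) (numCols (suc m) l)
    ≡⟨ cong (allBelow (okA ∘ suc)) numCols-split ⟩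
      allBelow (okA ∘ suc) (x0 + suc m)
    ≡⟨ allBelow-+ (okA ∘ suc) x0 (suc m) ⟩
      allBelow (okA ∘ suc) x0 ∧ okA (suc (x0 + 0)) ∧ allBelow (λ y → okA (suc (x0 + suc y))) m
    ≡⟨ cong₂ _∧_ (allBelow-cong _ _ x0 okA-before) (cong₂ _∧_ okA-at (allBelow-cong _ _ m (λ y _ → okA-after y))) ⟩
      okBefore ∧ (okAt ∧ zeroLast) ∧ okAfter
    ∎
    where
    open ≡-Reasoning
    okA-at : okA (suc (x0 + 0)) ≡ okAt ∧ zeroLast
    okA-at = trans (cong (okA ∘ suc) (+-identityʳ x0))
               (trans (cong columnOK column-middle-p1) (columnOK-∷ʳ-p1 (column m (l + 2) B (suc m + suc l'))))
    okA-after : ∀ y → okA (suc (x0 + suc y)) ≡ okB (suc (x0 + suc y))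
    okA-after y = trans (cong okA (after-index y))
                    (trans (cong columnOK (proj₁ (same-column-right y))) (cong okB (sym (after-index y))))

  columnsOK-B : columnsOK m (l + 2) B ≡ okBefore ∧ okAt ∧ okAfter
  columnsOK-B = trans (allL-range1 okB (numCols m (l + 2)))
    (trans (cong (allBelow (okB ∘ suc)) (trans (sym numCols-shift) numCols-split))
    (trans (allBelow-+ (okB ∘ suc) x0 (suc m)) (cong (okBefore ∧_) (cong (_∧ okAfter) (cong (okB ∘ suc) (+-identityʳ x0))))))

  okBefore⇒okFirst : okBefore ≡ true → okB (suc m) ≡ true
  okBefore⇒okFirst ok = allBelow-at (okB ∘ suc) x0 ok m (m<m+n m (s≤s z≤n))

  centralZero-A : centralZero (suc m) l A ≡ zeroInner
  centralZero-A = begin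
      centralZero (suc m) l A
    ≡⟨ allL-rangeFT (λ c → sumE (column (suc m) l A c) ==ℤ ℤ.0ℤ) (suc (suc m)) (suc m + l ∸ 2) ⟩
      allBelow (λ x → sumE (column (suc m) l A (suc (suc m) + x)) ==ℤ ℤ.0ℤ) (suc (suc m + l ∸ 2) ∸ suc (suc m))
    ≡⟨ cong (allBelow (λ x → sumE (column (suc m) l A (suc (suc m) + x)) ==ℤ ℤ.0ℤ)) (centralCount (suc m) l') ⟩
      allBelow (λ x → sumE (column (suc m) l A (suc (suc m) + x)) ==ℤ ℤ.0ℤ) l'
    ≡⟨ allBelow-cong _ _ l' (λ x lt → cong (_==ℤ ℤ.0ℤ) (trans (cong (λ c → sumE (column (suc m) l A c)) (sym (cong suc (+-suc m x))))
         (trans (cong sumE (column-middle-z0 (suc x) lt)) (sumE-∷ʳ-z0 (column m (l + 2) B (suc m + suc x)))))) ⟩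
      zeroInner
    ∎
    where open ≡-Reasoning

  centralZero-B : centralZero m (l + 2) B ≡ zeroFirst ∧ zeroInner ∧ zeroLast
  centralZero-B = trans (allL-rangeFT (λ c → sumB c ==ℤ ℤ.0ℤ) (suc m) (m + (l + 2) ∸ 2))
    (trans (cong (allBelow (λ x → sumB (suc m + x) ==ℤ ℤ.0ℤ)) centralCount-shift)
    (cong₂ _∧_ (cong (λ c → sumB c ==ℤ ℤ.0ℤ) (+-identityʳ (suc m)))
       (allBelow-suc (λ x → sumB (suc m + suc x) ==ℤ ℤ.0ℤ) l')))

  isOneCol-A-first : isOneCol (suc m) l A (suc m) ≡ oneFirst
  isOneCol-A-first = cong (_==ℤ ℤ.1ℤ) (begin
      sumE (column (suc m) l A (suc m))                 ≡⟨ cong (λ c → sumE (column (suc m) l A c)) (+-identityʳ (suc m)) ⟨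
      sumE (column (suc m) l A (suc m + 0))             ≡⟨ cong sumE (column-middle-z0 0 z≤n) ⟩
      sumE (column m (l + 2) B (suc m + 0) ∷ʳ z0)       ≡⟨ sumE-∷ʳ-z0 (column m (l + 2) B (suc m + 0)) ⟩
      sumB (suc m + 0)                                  ≡⟨ cong sumB (+-identityʳ (suc m)) ⟩
      sumB (suc m)                                      ∎)
    where open ≡-Reasoning

  isOneCol-A-last : isOneCol (suc m) l A (suc m + suc l') ≡ zeroLast
  isOneCol-A-last = trans (cong (λ xs → sumE xs ==ℤ ℤ.1ℤ) column-middle-p1) (oneSum-∷ʳ-p1 (column m (l + 2) B (suc m + suc l')))

  isOneCol-A-left : ∀ x → isOneCol (suc m) l A (m ∸ x) ≡ isOneCol m (l + 2) B (m ∸ x)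
  isOneCol-A-left x = cong (λ xs → sumE xs ==ℤ ℤ.1ℤ) (proj₁ (same-column-left (m ∸ x) (m∸n≤m m x)))

  isTenCol-A-left : ∀ x → isTenCol (suc m) l A (m ∸ x) ≡ isTenCol m (l + 2) B (m ∸ x)
  isTenCol-A-left x = cong₂ (λ xs e → (sumE xs ==ℤ ℤ.1ℤ) ∧ isZero e)
    (proj₁ (same-column-left (m ∸ x) (m∸n≤m m x))) (proj₂ (same-column-left (m ∸ x) (m∸n≤m m x)))

  isOneCol-A-right : ∀ x → isOneCol (suc m) l A (rightCol (suc m) l (suc (suc x))) ≡ isOneCol m (l + 2) B (rightCol m (l + 2) (suc x))
  isOneCol-A-right x = begin
      isOneCol (suc m) l A (rightCol (suc m) l (suc (suc x)))  ≡⟨ cong (isOneCol (suc m) l A) (rightCol-shiftˡ x) ⟩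
      isOneCol (suc m) l A (suc m + (l + x))                   ≡⟨ cong (λ xs → sumE xs ==ℤ ℤ.1ℤ) (proj₁ (same-column-right x)) ⟩
      isOneCol m (l + 2) B (suc m + (l + x))                   ≡⟨ cong (isOneCol m (l + 2) B) (rightCol-shiftʳ x) ⟨
      isOneCol m (l + 2) B (rightCol m (l + 2) (suc x))        ∎
    where open ≡-Reasoning

  isTenCol-A-right : ∀ x → isTenCol (suc m) l A (rightCol (suc m) l (suc (suc x))) ≡ isTenCol m (l + 2) B (rightCol m (l + 2) (suc x))
  isTenCol-A-right x = begin
      isTenCol (suc m) l A (rightCol (suc m) l (suc (suc x)))  ≡⟨ cong (isTenCol (suc m) l A) (rightCol-shiftˡ x) ⟩
      isTenCol (suc m) l A (suc m + (l + x))                   ≡⟨ cong₂ (λ xs e → (sumE xs ==ℤ ℤ.1ℤ) ∧ isZero e)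
                                                                    (proj₁ (same-column-right x)) (proj₂ (same-column-right x)) ⟩
      isTenCol m (l + 2) B (suc m + (l + x))                   ≡⟨ cong (isTenCol m (l + 2) B) (rightCol-shiftʳ x) ⟨
      isTenCol m (l + 2) B (rightCol m (l + 2) (suc x))        ∎
    where open ≡-Reasoning

  i : ℕ
  i = suc (suc i1)

  leftOK-A : leftOK (suc m) l i A ≡ not oneFirst ∧ leftOK m (l + 2) (suc i1) B
  leftOK-A = trans (allL-range1 (λ i' → isOneCol (suc m) l A (leftCol (suc m) i') ==B (i' ≡ᵇ i)) (suc m))
    (cong₂ _∧_ (trans (==B-false _) (cong not isOneCol-A-first))
      (sym (trans (allL-range1 (λ i' → isOneCol m (l + 2) B (leftCol m i') ==B (i' ≡ᵇ suc i1)) m)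
        (allBelow-cong _ _ m (λ x _ → cong (_==B (suc x ≡ᵇ suc i1)) (sym (isOneCol-A-left x)))))))

  rightOK-A : rightOK (suc m) l (suc m) A ≡ zeroLast ∧ rightOK m (l + 2) m B
  rightOK-A = trans (allL-range1 (λ j' → not (isOneCol (suc m) l A (rightCol (suc m) l j')) ==B (j' ≡ᵇ suc m)) (suc m))
    (cong₂ _∧_ (trans (==B-false _) (trans (not-involutive _) (trans (cong (isOneCol (suc m) l A) rightCol-1) isOneCol-A-last)))
      (sym (trans (allL-range1 (λ j' → not (isOneCol m (l + 2) B (rightCol m (l + 2) j')) ==B (j' ≡ᵇ m)) m)
        (allBelow-cong _ _ m (λ x _ → cong (λ z → not z ==B (suc x ≡ᵇ m)) (sym (isOneCol-A-right x)))))))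

  rowsOK-A : rowsOK A ≡ rowsOK B
  rowsOK-A = trans (rowsOK-∷ʳ B) (∧-identityʳ (rowsOK B))
    where
    rowsOK-∷ʳ : ∀ C → rowsOK (C ∷ʳ t) ≡ rowsOK C ∧ true
    rowsOK-∷ʳ [] = trans (∧-identityʳ _) (unitRow-ok (suc l'))
    rowsOK-∷ʳ (r ∷ C) = trans (cong ((alternates r ∧ (sumE r ==ℤ ℤ.1ℤ)) ∧_) (rowsOK-∷ʳ C))
                              (sym (∧-assoc (alternates r ∧ (sumE r ==ℤ ℤ.1ℤ)) (rowsOK C) true))

  μ-A : μ A ≡ μ B
  μ-A = begin
      count isNeg (concat (B ∷ʳ t))          ≡⟨ cong (count isNeg) (concat-++ B [ t ]) ⟨
      count isNeg (concat B ++ (t ++ []))    ≡⟨ count-++ isNeg (concat B) (t ++ []) ⟩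
      μ B + count isNeg (t ++ [])            ≡⟨ cong (λ r → μ B + count isNeg r) (++-identityʳ t) ⟩
      μ B + count isNeg t                    ≡⟨ cong (μ B +_) (μ-unitRow (suc l')) ⟩
      μ B + 0                                ≡⟨ +-identityʳ (μ B) ⟩
      μ B                                    ∎
    where open ≡-Reasoning

  rStat-A : rStat (suc m) l A ≡ indicator oneFirst + rStat m (l + 2) B
  rStat-A = trans (count-range1 (λ i' → isOneCol (suc m) l A (leftCol (suc m) i')) (suc m))
    (cong₂ _+_ (cong indicator isOneCol-A-first)
      (sym (trans (count-range1 (λ i' → isOneCol m (l + 2) B (leftCol m i')) m)
        (countBelow-cong _ _ m (λ x _ → sym (isOneCol-A-left x))))))

  pStat-A : pStat (suc m) l A ≡ indicator (oneFirst ∧ isZero (bottomEntry (suc m) l A (suc m))) + pStat m (l + 2) B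
  pStat-A = trans (count-range1 (λ i' → isTenCol (suc m) l A (leftCol (suc m) i')) (suc m))
    (cong₂ _+_ (cong (λ z → indicator (z ∧ isZero (bottomEntry (suc m) l A (suc m)))) isOneCol-A-first)
      (sym (trans (count-range1 (λ i' → isTenCol m (l + 2) B (leftCol m i')) m)
        (countBelow-cong _ _ m (λ x _ → sym (isTenCol-A-left x))))))

  -- The column labelled 1 of A ends with the 1 of the unit row, so it is not a 10-column.
  qStat-A : qStat (suc m) l A ≡ qStat m (l + 2) B
  qStat-A = trans (count-range1 (λ j → isTenCol (suc m) l A (rightCol (suc m) l j)) (suc m))
    (cong₂ _+_ (cong indicator not-ten)
      (sym (trans (count-range1 (λ j → isTenCol m (l + 2) B (rightCol m (l + 2) j)) m)
        (countBelow-cong _ _ m (λ x _ → sym (isTenCol-A-right x))))))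
    where
    not-ten : isTenCol (suc m) l A (rightCol (suc m) l 1) ≡ false
    not-ten = trans (cong (isTenCol (suc m) l A) rightCol-1)
      (trans (cong (λ e → isOneCol (suc m) l A (suc m + suc l') ∧ isZero e)
                   (trans (bottomEntry-middle (suc l') ≤-refl) (nth-unitRow-last (suc l')))) (∧-zeroʳ _))

  contributes-A : ∀ a b c d → contributes (suc m) l i (suc m) a b c d A ≡ contributes m (l + 2) (suc i1) m a b c d B
  contributes-A a b c d = begin
      contributes (suc m) l i (suc m) a b c d A
    ≡⟨ cong₂ _∧_ (cong₂ _∧_ rowsOK-A (cong₂ _∧_ columnsOK-A centralZero-A))
                 (cong₂ _∧_ (cong₂ _∧_ leftOK-A rightOK-A)
                   (cong₂ _∧_ (cong (_≡ᵇ a) μ-A) (cong₂ _∧_ (cong (_≡ᵇ b) rStat-A) (cong₂ _∧_ (cong (_≡ᵇ c) pStat-A) refl)))) ⟩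
      (rowsOK B ∧ (okBefore ∧ (okAt ∧ zeroLast) ∧ okAfter) ∧ zeroInner)
        ∧ ((not oneFirst ∧ leftOK m (l + 2) (suc i1) B) ∧ (zeroLast ∧ rightOK m (l + 2) m B)) ∧ statsA oneFirst
    ≡⟨ reshuffle (rowsOK B) okBefore okAt zeroLast okAfter zeroInner oneFirst zeroFirst
                 (leftOK m (l + 2) (suc i1) B) (rightOK m (l + 2) m B) (statsA oneFirst) statsB
                 (λ ok → zeroSum≡not-oneSum (column m (l + 2) B (suc m)) (okBefore⇒okFirst ok)) (stats-agree oneFirst) ⟩
      (rowsOK B ∧ (okBefore ∧ okAt ∧ okAfter) ∧ (zeroFirst ∧ zeroInner ∧ zeroLast))
        ∧ (leftOK m (l + 2) (suc i1) B ∧ rightOK m (l + 2) m B) ∧ statsB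
    ≡⟨ cong₂ _∧_ (cong (rowsOK B ∧_) (cong₂ _∧_ columnsOK-B centralZero-B)) refl ⟨
      contributes m (l + 2) (suc i1) m a b c d B
    ∎
    where
    open ≡-Reasoning
    ζ statsB : Bool
    ζ = isZero (bottomEntry (suc m) l A (suc m))
    statsB = (μ B ≡ᵇ a) ∧ (rStat m (l + 2) B ≡ᵇ b) ∧ (pStat m (l + 2) B ≡ᵇ c) ∧ (qStat m (l + 2) B ≡ᵇ d)
    statsA : Bool → Bool
    statsA o = (μ B ≡ᵇ a) ∧ ((indicator o + rStat m (l + 2) B) ≡ᵇ b)
               ∧ ((indicator (o ∧ ζ) + pStat m (l + 2) B) ≡ᵇ c) ∧ (qStat (suc m) l A ≡ᵇ d)
    stats-agree : ∀ o → not o ∧ statsA o ≡ not o ∧ statsB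
    stats-agree true = refl
    stats-agree false = cong (λ q → (μ B ≡ᵇ a) ∧ (rStat m (l + 2) B ≡ᵇ b) ∧ (pStat m (l + 2) B ≡ᵇ c) ∧ (q ≡ᵇ d)) qStat-A

allL-∷ʳ : {X : Set} (f : X → Bool) (xs : List X) (x : X) → allL f (xs ∷ʳ x) ≡ true → f x ≡ true
allL-∷ʳ f [] x ok = ∧-conicalˡ (f x) true ok
allL-∷ʳ f (y ∷ xs) x ok = allL-∷ʳ f xs x (∧-conicalʳ (f y) _ ok)

-- The bottom row meets column −1 (a 0-column as i ≥ 2), the l − 2 central columns (sum 0) and
-- column 1 (a 1-column as m + 1 ≥ 2).
bottomRow-forced : ∀ m0 l' i1 a b c d B w → length B ≡ suc m0 → length w ≡ suc (suc l') →
  contributes (suc (suc m0)) (suc (suc l')) (suc (suc i1)) (suc (suc m0)) a b c d (B ∷ʳ w) ≡ true →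
  w ≡ unitRow (suc l')
bottomRow-forced m0 l' i1 a b c d B w lenB lenw ok = unitRow-from-bottom (suc l') w lenw no-p1 last≢m1 row-sum
  where
  m i : ℕ
  m = suc m0
  i = suc (suc i1)
  open BottomRow m l'
  open Snoc B w lenB
  open Contributing (suc m) l i (suc m) a b c d A ok
  row-sum : sumE w ≡ ℤ.1ℤ
  row-sum = ==ℤ-sound _ _ (∧-conicalʳ (alternates w) _ (allL-∷ʳ (λ row → alternates row ∧ (sumE row ==ℤ ℤ.1ℤ)) B w rowsOK-true))
  columnOK-middle : ∀ x → x ≤ suc l' → columnOK (column (suc m) l A (suc m + x)) ≡ true
  columnOK-middle x le = columnOK-at (suc m) l A columnsOK-true (m + x)
    (subst (m + x <_) (sym numCols-split) (≤-<-trans (+-monoʳ-≤ m le) (m<m+n (m + suc l') (s≤s z≤n))))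
  not-one : ∀ x → x < suc l' → isOneCol (suc m) l A (suc m + x) ≡ false
  not-one zero _ = trans (cong (isOneCol (suc m) l A) (+-identityʳ (suc m)))
    (trans (sym (not-involutive _)) (cong not (trans (sym (==B-false _)) (leftOK-at (suc m) l i A leftOK-true 0 (s≤s z≤n)))))
  not-one (suc x) (s≤s lt) = trans (cong (isOneCol (suc m) l A) (cong suc (+-suc m x)))
    (cong (_==ℤ ℤ.1ℤ) (==ℤ-sound (sumE (column (suc m) l A (suc (suc m) + x))) ℤ.0ℤ (centralZero-at (suc m) l' A centralZero-true x lt)))
  no-p1 : NoEntry p1 w (suc l')
  no-p1 x lt e = false≢true (trans (sym (not-one x lt)) (trans (cong (λ xs → sumE xs ==ℤ ℤ.1ℤ) column-p1)
    (columnOK-∷ʳ-p1⇒oneSum (column m (l + 2) B (suc m + x)) (trans (cong columnOK (sym column-p1)) (columnOK-middle x (<⇒≤ lt))))))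
    where
    column-p1 : column (suc m) l A (suc m + x) ≡ column m (l + 2) B (suc m + x) ∷ʳ p1
    column-p1 = trans (column-middle x (<⇒≤ lt)) (cong (column m (l + 2) B (suc m + x) ∷ʳ_) e)
  last-one : isOneCol (suc m) l A (suc m + suc l') ≡ true
  last-one = trans (cong (isOneCol (suc m) l A) (sym rightCol-1))
    (trans (sym (not-involutive _)) (trans (sym (==B-false _)) (rightOK-at (suc m) l (suc m) A rightOK-true 0 (s≤s z≤n))))
  last≢m1 : nth z0 w (suc l') ≢ m1
  last≢m1 e = false≢true (trans (sym (trans (cong (λ xs → sumE xs ==ℤ ℤ.1ℤ) column-m1)
    (columnOK-∷ʳ-m1⇒¬oneSum (column m (l + 2) B (suc m + suc l')) (trans (cong columnOK (sym column-m1)) (columnOK-middle (suc l') ≤-refl))))) last-one)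
    where
    column-m1 : column (suc m) l A (suc m + suc l') ≡ column m (l + 2) B (suc m + suc l') ∷ʳ m1
    column-m1 = trans (column-middle (suc l') ≤-refl) (cong (column m (l + 2) B (suc m + suc l') ∷ʳ_) e)

sumBy-bottom-row : ∀ m0 l' i1 a b c d B → length B ≡ suc m0 →
  sumBy (λ w → indicator (contributes (suc (suc m0)) (suc (suc l')) (suc (suc i1)) (suc (suc m0)) a b c d (B ∷ʳ w)))
        (words (suc (suc l')))
  ≡ indicator (contributes (suc m0) (suc (suc l') + 2) (suc i1) (suc m0) a b c d B)
sumBy-bottom-row m0 l' i1 a b c d B lenB = begin
    sumBy (λ w → indicator (P (B ∷ʳ w))) (words (suc (suc l')))
  ≡⟨ cong (λ k → sumBy (λ w → indicator (P (B ∷ʳ w))) (words k)) (sym (length-unitRow (suc l'))) ⟩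
    sumBy (λ w → indicator (P (B ∷ʳ w))) (words (length t))
  ≡⟨ sumBy-words-at t (λ w → indicator (P (B ∷ʳ w))) off ⟩
    indicator (P (B ∷ʳ t))
  ≡⟨ cong indicator (BottomUnitRow.contributes-A m0 l' i1 B lenB a b c d) ⟩
    indicator (contributes (suc m0) (suc (suc l') + 2) (suc i1) (suc m0) a b c d B)
  ∎
  where
  open ≡-Reasoning
  P : Array → Bool
  P = contributes (suc (suc m0)) (suc (suc l')) (suc (suc i1)) (suc (suc m0)) a b c d
  t : List E
  t = unitRow (suc l')
  off : ∀ w → length w ≡ length t → w ≢ t → indicator (P (B ∷ʳ w)) ≡ 0
  off w len w≢t with P (B ∷ʳ w) in ok
  ... | false = refl
  ... | true = ⊥-elim (w≢t (bottomRow-forced m0 l' i1 a b c d B w lenB (trans len (length-unitRow (suc l'))) ok))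

Z-bottom-row : ∀ m0 l' i1 →
  Z (suc (suc m0)) (suc (suc l')) (suc (suc i1)) (suc (suc m0)) ≈P Z (suc m0) (suc (suc l') + 2) (suc i1) (suc m0)
Z-bottom-row m0 l' i1 a b c d = begin
    Z (suc m) l i (suc m) a b c d
  ≡⟨ Z-as-sumBy (suc m) l i (suc m) a b c d ⟩
    sumBy (indicator ∘ P) (arrays (suc m) l)
  ≡⟨ cong (sumBy (indicator ∘ P)) arrays-snoc ⟩
    sumBy (indicator ∘ P) (seqs (upperRows ∷ʳ words l))
  ≡⟨ sumBy-seqs-∷ʳ (indicator ∘ P) upperRows (words l) ⟩
    sumBy (λ B → sumBy (λ w → indicator (P (B ∷ʳ w))) (words l)) (arrays m (l + 2))
  ≡⟨ sumBy-congᴬ (seqs-length upperRows) (λ {B} lenB → sumBy-bottom-row m0 l' i1 a b c d B (trans lenB length-upperRows)) ⟩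
    sumBy (indicator ∘ contributes m (l + 2) (suc i1) m a b c d) (arrays m (l + 2))
  ≡⟨ Z-as-sumBy m (l + 2) (suc i1) m a b c d ⟨
    Z m (l + 2) (suc i1) m a b c d
  ∎
  where
  open ≡-Reasoning
  m i : ℕ
  m = suc m0
  i = suc (suc i1)
  open BottomRow m l'
  P : Array → Bool
  P = contributes (suc m) l i (suc m) a b c d

module OneRow (l' : ℕ) where

  l : ℕ
  l = suc (suc l')

  u : List E
  u = p1 ∷ replicate (suc l') z0

  length-u : length u ≡ l
  length-u = cong (suc ∘ suc) (length-replicate l')

  column-one-row : ∀ w x → x < l → column 1 l [ w ] (suc x) ≡ [ nth z0 w x ]
  column-one-row w x lt =
    trans (column-topEntries 1 l [ w ] (suc x)) (cong (λ h → topEntries [ w ] h (suc x)) (m≤n⇒m⊓n≡m (m<n⇒0<n∸m lt)))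

  bottomEntry-one-row : ∀ w x → x < l → bottomEntry 1 l [ w ] (suc x) ≡ nth z0 w x
  bottomEntry-one-row w x lt = cong (λ h → entry [ w ] h (suc x)) (m≤n⇒m⊓n≡m (m<n⇒0<n∸m lt))

  -- Every column of a one-row array is a single entry: −1 is excluded, the l−2 central entries
  -- vanish, the entry in column 1 (a 0-column) vanishes, and the row sum 1 makes the first entry 1.
  oneRow-forced : ∀ i a b c d w → length w ≡ l → contributes 1 l i 1 a b c d [ w ] ≡ true → w ≡ u
  oneRow-forced i a b c d (e ∷ w) len ok = cong₂ _∷_ first-p1 tail-zero
    where
    open Contributing 1 l i 1 a b c d [ e ∷ w ] ok
    entry-ok : ∀ x → x < l → columnOK [ nth z0 (e ∷ w) x ] ≡ true
    entry-ok x lt = trans (cong columnOK (sym (column-one-row (e ∷ w) x lt))) (columnOK-at 1 l [ e ∷ w ] columnsOK-true x lt)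
    central-zero : ∀ x → x < l' → nth z0 w x ≡ z0
    central-zero x lt = zero-sum (nth z0 w x) (trans (cong (λ xs → sumE xs ==ℤ ℤ.0ℤ)
        (sym (column-one-row (e ∷ w) (suc x) (s≤s (m≤n⇒m≤1+n lt)))))
      (centralZero-at 1 l' [ e ∷ w ] centralZero-true x lt))
      where
      zero-sum : ∀ e → (sumE [ e ] ==ℤ ℤ.0ℤ) ≡ true → e ≡ z0
      zero-sum z0 _ = refl
    last-zero : nth z0 w l' ≡ z0
    last-zero = zero-column (nth z0 w l') (entry-ok (suc l') ≤-refl) (trans (sym last-isOne) (trans (sym (not-involutive _))
      (cong not (trans (sym (==B-true _)) (rightOK-at 1 l 1 [ e ∷ w ] rightOK-true 0 (s≤s z≤n))))))
      where
      last-isOne : isOneCol 1 l [ e ∷ w ] (rightCol 1 l 1) ≡ (sumE [ nth z0 w l' ] ==ℤ ℤ.1ℤ)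
      last-isOne = trans (cong (isOneCol 1 l [ e ∷ w ]) (+-comm (suc l') 1))
                         (cong (λ xs → sumE xs ==ℤ ℤ.1ℤ) (column-one-row (e ∷ w) (suc l') ≤-refl))
      zero-column : ∀ e → columnOK [ e ] ≡ true → (sumE [ e ] ==ℤ ℤ.1ℤ) ≡ false → e ≡ z0
      zero-column z0 _ _ = refl
    tail-zero : w ≡ replicate (suc l') z0
    tail-zero = replicate-z0 (suc l') w (suc-injective len) zero-below
      where
      zero-below : ∀ x → x < suc l' → nth z0 w x ≡ z0
      zero-below x (s≤s x≤l') with m≤n⇒m<n∨m≡n x≤l'
      ... | inj₁ x<l' = central-zero x x<l'
      ... | inj₂ refl = last-zero
    first-p1 : e ≡ p1
    first-p1 = one e (trans (cong (λ v → val e ℤ.+ sumE v) (sym tail-zero))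
      (==ℤ-sound _ _ (∧-conicalʳ (alternates (e ∷ w)) _ (∧-conicalˡ _ true rowsOK-true))))
      where
      one : ∀ e → val e ℤ.+ sumE (replicate (suc l') z0) ≡ ℤ.1ℤ → e ≡ p1
      one e s rewrite sumE-replicate-z0 (suc l') with e | s
      ... | p1 | _ = refl

  column-u-first : column 1 l [ u ] 1 ≡ [ p1 ]
  column-u-first = column-one-row u 0 (s≤s z≤n)

  column-u-rest : ∀ x → x < suc l' → column 1 l [ u ] (suc (suc x)) ≡ [ z0 ]
  column-u-rest x lt = trans (column-one-row u (suc x) (s≤s lt)) (cong [_] (nth-replicate (suc l') x))
    where
    nth-replicate : ∀ k x → nth z0 (replicate k z0) x ≡ z0
    nth-replicate zero x = refl
    nth-replicate (suc k) zero = refl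
    nth-replicate (suc k) (suc x) = nth-replicate k x

  isOneCol-u-first : isOneCol 1 l [ u ] 1 ≡ true
  isOneCol-u-first = cong (λ xs → sumE xs ==ℤ ℤ.1ℤ) column-u-first

  isOneCol-u-right : isOneCol 1 l [ u ] (rightCol 1 l 1) ≡ false
  isOneCol-u-right = cong (λ xs → sumE xs ==ℤ ℤ.1ℤ) (trans (cong (column 1 l [ u ]) (+-comm (suc l') 1)) (column-u-rest l' ≤-refl))

  nonzeros-replicate : ∀ k → nonzeros (replicate k z0) ≡ []
  nonzeros-replicate zero = refl
  nonzeros-replicate (suc k) = nonzeros-replicate k

  μ-u : μ [ u ] ≡ 0
  μ-u = trans (count-++ isNeg (replicate (suc l') z0) []) (cong (_+ 0) (count-z0 (suc l')))
    where
    count-z0 : ∀ k → count isNeg (replicate k z0) ≡ 0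
    count-z0 zero = refl
    count-z0 (suc k) = count-z0 k

  isASTZ-u : isASTZ 1 l [ u ] ≡ true
  isASTZ-u = cong₂ _∧_ rows (cong₂ _∧_ columns central)
    where
    rows : rowsOK [ u ] ≡ true
    rows rewrite nonzeros-replicate (suc l') | sumE-z0 (replicate l' z0) | sumE-replicate-z0 l' = refl
    columns : columnsOK 1 l [ u ] ≡ true
    columns = trans (allL-range1 (λ c → columnOK (column 1 l [ u ] c)) l) (allBelow-intro _ l ok)
      where
      ok : ∀ c → c < l → columnOK (column 1 l [ u ] (suc c)) ≡ true
      ok zero _ = cong columnOK column-u-first
      ok (suc c) (s≤s lt) = cong columnOK (column-u-rest c lt)
    central : centralZero 1 l [ u ] ≡ true
    central = trans (allL-rangeFT (λ c → sumE (column 1 l [ u ] c) ==ℤ ℤ.0ℤ) 2 (1 + l ∸ 2))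
      (allBelow-intro _ l' (λ x lt → cong (λ xs → sumE xs ==ℤ ℤ.0ℤ) (column-u-rest x (m≤n⇒m≤1+n lt))))

  contributes-u : ∀ i a b c d →
    contributes 1 l i 1 a b c d [ u ] ≡ ((1 ≡ᵇ i) ∧ true) ∧ (0 ≡ᵇ a) ∧ (1 ≡ᵇ b) ∧ (0 ≡ᵇ c) ∧ (0 ≡ᵇ d)
  contributes-u i a b c d = cong₂ _∧_ isASTZ-u (cong₂ _∧_ (cong₂ _∧_ leftOK-u rightOK-u)
    (cong₂ _∧_ (cong (_≡ᵇ a) μ-u) (cong₂ _∧_ (cong (_≡ᵇ b) rStat-u) (cong₂ _∧_ (cong (_≡ᵇ c) pStat-u) (cong (_≡ᵇ d) qStat-u)))))
    where
    leftOK-u : leftOK 1 l i [ u ] ≡ (1 ≡ᵇ i)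
    leftOK-u = trans (cong (λ z → (z ==B (1 ≡ᵇ i)) ∧ true) isOneCol-u-first) (∧-identityʳ (1 ≡ᵇ i))
    rightOK-u : rightOK 1 l 1 [ u ] ≡ true
    rightOK-u = cong (λ z → (not z ==B true) ∧ true) isOneCol-u-right
    rStat-u : rStat 1 l [ u ] ≡ 1
    rStat-u = trans (count-∷ (λ i → isOneCol 1 l [ u ] (leftCol 1 i)) 1 []) (cong (λ z → indicator z + 0) isOneCol-u-first)
    pStat-u : pStat 1 l [ u ] ≡ 0
    pStat-u = trans (count-∷ (λ i → isTenCol 1 l [ u ] (leftCol 1 i)) 1 [])
      (cong (λ z → indicator z + 0) (cong₂ (λ o e → o ∧ isZero e) isOneCol-u-first (bottomEntry-one-row u 0 (s≤s z≤n))))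
    qStat-u : qStat 1 l [ u ] ≡ 0
    qStat-u = trans (count-∷ (λ j → isTenCol 1 l [ u ] (rightCol 1 l j)) 1 [])
      (cong (λ z → indicator z + 0) (cong (_∧ isZero (bottomEntry 1 l [ u ] (rightCol 1 l 1))) isOneCol-u-right))

  Z-one-row : ∀ i a b c d → Z 1 l i 1 a b c d ≡ indicator (contributes 1 l i 1 a b c d [ u ])
  Z-one-row i a b c d = begin
      Z 1 l i 1 a b c d
    ≡⟨ Z-as-sumBy 1 l i 1 a b c d ⟩
      sumBy (indicator ∘ P) (seqs [ words (rowLen 1 l 1) ])
    ≡⟨ sumBy-seqs-∷ (indicator ∘ P) (words (rowLen 1 l 1)) [] ⟩
      sumBy (λ w → indicator (P [ w ]) + 0) (words (rowLen 1 l 1))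
    ≡⟨ sumBy-cong (words (rowLen 1 l 1)) (λ w → +-identityʳ _) ⟩
      sumBy (λ w → indicator (P [ w ])) (words l)
    ≡⟨ cong (λ k → sumBy (λ w → indicator (P [ w ])) (words k)) length-u ⟨
      sumBy (λ w → indicator (P [ w ])) (words (length u))
    ≡⟨ sumBy-words-at u (λ w → indicator (P [ w ])) off ⟩
      indicator (P [ u ])
    ∎
    where
    open ≡-Reasoning
    P : Array → Bool
    P = contributes 1 l i 1 a b c d
    off : ∀ w → length w ≡ length u → w ≢ u → indicator (P [ w ]) ≡ 0
    off w len w≢u with P [ w ] in ok
    ... | false = refl
    ... | true = ⊥-elim (w≢u (oneRow-forced i a b c d w (trans len length-u) ok))

  Z-one-row-diagonal : Z 1 l 1 1 ≈P RP
  Z-one-row-diagonal a b c d = begin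
      Z 1 l 1 1 a b c d
    ≡⟨ trans (Z-one-row 1 a b c d) (cong indicator (contributes-u 1 a b c d)) ⟩
      indicator ((0 ≡ᵇ a) ∧ (1 ≡ᵇ b) ∧ (0 ≡ᵇ c) ∧ (0 ≡ᵇ d))
    ≡⟨ cong indicator (cong₂ _∧_ (≡ᵇ-comm 0 a) (cong₂ _∧_ (≡ᵇ-comm 1 b) (cong₂ _∧_ (≡ᵇ-comm 0 c) (≡ᵇ-comm 0 d)))) ⟩
      indicator ((a ≡ᵇ 0) ∧ (b ≡ᵇ 1) ∧ (c ≡ᵇ 0) ∧ (d ≡ᵇ 0))
    ≡⟨ indicator-if _ ⟩
      RP a b c d
    ∎
    where open ≡-Reasoning

  Z-one-row-below : ∀ i1 → Z 1 l (suc (suc i1)) 1 ≈P 0P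
  Z-one-row-below i1 a b c d = trans (Z-one-row (suc (suc i1)) a b c d) (cong indicator (contributes-u (suc (suc i1)) a b c d))

Z-beyond : ∀ m l' i j → suc m < i → 1 ≤ j → j ≤ suc m → Z (suc m) (suc (suc l')) i j ≈P 0P
Z-beyond zero l' (suc (suc i1)) (suc zero) _ _ _ = OneRow.Z-one-row-below l' i1
Z-beyond zero l' (suc zero) j (s≤s ()) _ _
Z-beyond zero l' i (suc (suc j)) _ _ (s≤s ())
Z-beyond (suc m) l' i j m<i 1≤j j≤ with m≤n⇒m<n∨m≡n j≤
... | inj₁ (s≤s j≤m) = ≈P-trans (Z-top-row-≢ (suc m) l' i j j≤m (λ e → <-irrefl e m<i))
                                (Z-beyond m l' i j (≤-trans (n≤1+n _) m<i) 1≤j j≤m)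
Z-beyond (suc m) l' (suc (suc i1)) j (s≤s m<i) 1≤j j≤ | inj₂ refl =
  ≈P-trans (Z-bottom-row m l' i1) (Z-beyond m (l' + 2) (suc i1) (suc m) m<i (s≤s z≤n) ≤-refl)

Z-below-diagonal : ∀ m l' i j → 1 ≤ j → j < i → i ≤ suc m → Z (suc m) (suc (suc l')) i j ≈P 0P
Z-below-diagonal zero l' (suc zero) (suc j) (s≤s _) (s≤s ()) _
Z-below-diagonal zero l' (suc (suc i)) j _ _ (s≤s ())
Z-below-diagonal (suc m) l' i j 1≤j j<i i≤ with m≤n⇒m<n∨m≡n i≤
... | inj₁ (s≤s i≤m) = ≈P-trans (Z-top-row-≢ (suc m) l' i j (≤-trans (n≤1+n _) (≤-trans j<i i≤m)) (λ e → 1+n≰n (subst (_≤ suc m) (sym e) i≤m)))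
                                (Z-below-diagonal m l' i j 1≤j j<i i≤m)
... | inj₂ refl = Z-top-row-≡ (suc m) l' j (≤-pred j<i)

Z-diagonal : ∀ m l' i → 1 ≤ i → i ≤ suc m → Z (suc m) (suc (suc l')) i i ≈P RP
Z-diagonal zero l' (suc zero) _ _ = OneRow.Z-one-row-diagonal l'
Z-diagonal zero l' (suc (suc i)) _ (s≤s ())
Z-diagonal (suc m) l' i 1≤i i≤ with m≤n⇒m<n∨m≡n i≤
... | inj₁ (s≤s i≤m) = ≈P-trans (Z-top-row-≢ (suc m) l' i i i≤m (λ e → 1+n≰n (subst (_≤ suc m) (sym e) i≤m)))
                                (Z-diagonal m l' i 1≤i i≤m)
... | inj₂ refl = ≈P-trans (Z-bottom-row m l' m) (Z-diagonal m (l' + 2) (suc m) (s≤s z≤n) ≤-refl)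

Z-remove-top-row : ∀ m l' i j → 1 ≤ j → j ≤ m → Z (suc m) (suc (suc l')) i j ≈P Z m (suc (suc l')) i j
Z-remove-top-row m l' i j 1≤j j≤m with suc m ≟ i
... | no ne = Z-top-row-≢ m l' i j j≤m ne
... | yes refl = λ a b c d → trans (Z-top-row-≡ m l' j j≤m a b c d) (sym (beyond m j≤m a b c d))
  where
  beyond : ∀ m → j ≤ m → Z m (suc (suc l')) (suc m) j ≈P 0P
  beyond zero j≤0 = ⊥-elim (1+n≰n (≤-trans 1≤j j≤0))
  beyond (suc m') j≤m = Z-beyond m' l' (suc (suc m')) j ≤-refl 1≤j j≤m

Z-remove-bottom-row : ∀ m l' i → 1 < i → i ≤ suc m →
  Z (suc m) (suc (suc l')) i (suc m) ≈P Z m (suc (suc l') + 2) (i ∸ 1) m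
Z-remove-bottom-row (suc m0) l' (suc (suc i1)) _ _ = Z-bottom-row m0 l' i1
Z-remove-bottom-row zero l' (suc (suc i1)) _ (s≤s ())
Z-remove-bottom-row m l' (suc zero) (s≤s ()) _

mainTheorem1 : (n l i j : ℕ) → 1 ≤ n → 2 ≤ l → 1 ≤ i → i ≤ n → 1 ≤ j → j ≤ n →
    ((j < i → Z n l i j ≈P 0P) × (i ≡ j → Z n l i j ≈P RP))
    × (j < n → Z n l i j ≈P Z (n ∸ 1) l i j)
    × (1 < i → Z n l i n ≈P Z (n ∸ 1) (l + 2) (i ∸ 1) (n ∸ 1))
mainTheorem1 (suc m) (suc (suc l')) i j _ (s≤s (s≤s z≤n)) 1≤i i≤n 1≤j j≤n =
    ( (λ j<i → Z-below-diagonal m l' i j 1≤j j<i i≤n)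
    , (λ { refl → Z-diagonal m l' i 1≤i i≤n }) )
  , (λ j<n → Z-remove-top-row m l' i j 1≤j (≤-pred j<n))
  , (λ 1<i → Z-remove-bottom-row m l' i 1<i i≤n)
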